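{- Let $C$ be a multi-complex and let $\mathcal{T}$ be the set of isomorphism classes of connected multi-complexes. Then $[C]$ can be written, as an element of $H_{\mathcal{C}}$, as a polynomial with non-negative integer coefficients in the elements $\{P_D\}_{D\in\mathcal{T}}$.
   Context: A multiset based on a set $S$ is a function $S\to\{1,2,3,\dots\}$; $S$ is its support $\mathrm{supp}$. A multi-complex $C$ consists of a finite base set $n_C$, a finite family $\{A_i\}_{i\in I}$ of non-empty multisets (repetitions allowed) whose supports are subsets of $n_C$, and a partial order $\preceq$ on this family such that (1) for each $k\in n_C$ the singleton $\{k\}$ occurs exactly once among the $A_i$, and $\{k\}\preceq A_i$ iff $k$ belongs to $A_i$; (2) if $A_i\preceq A_j$ then $A_i$ is contained in $A_j$. Isomorphism: bijection of base sets inducing a bijection of families preserving and reflecting $\preceq$. A sub-multi-complex is a downward closed subfamily with inherited order; $D\preceq C$ means $D$ is a sub-multi-complex of $C$ with $n_D=n_C$. Elements $a,b\in n_C$ are path-connected if there are $a=a_0,\dots,a_l=b$ and members $A_1,\dots,A_l$ with $\{a_{j-1},a_j\}\subseteq\mathrm{supp}(A_j)$; $C$ is connected if any two elements of $n_C$ are path-connected. $H_{\mathcal{C}}$ is the algebra over a field of characteristic $0$ with basis the isomorphism classes $[C]$ of multi-complexes and product $[C][D]=[C\sqcup D]$ (disjoint union of base sets and families, induced order). For $C$, let $X_C=\{D:D\preceq C\}$ ordered by being a sub-multi-complex, with Möbius function $\mu_P$, and $P_C=\sum_{D\preceq C}\mu_P(D,C)[D]$ (sum over all such sub-multi-complexes).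 -}

module Defs where

open import Data.Nat as ℕ using (ℕ; zero; suc; _≤_; _<_; _≡ᵇ_)
open import Data.Integer as ℤ using (ℤ; 0ℤ; 1ℤ)
open import Data.Fin using (Fin; splitAt; _≟_)
open import Relation.Nullary.Decidable using (isYes)
open import Data.Bool using (Bool; true; false; _∧_; _∨_; not; if_then_else_; T)
open import Data.List using (List; []; _∷_; map; _++_; concatMap; foldr; allFin; filterᵇ; length; lookup)
open import Data.Nat.ListAction using (sum)
open import Data.Bool.ListAction using (and)
open import Data.Vec as Vec using (Vec; []; _∷_)
open import Data.Product using (Σ; ∃; ∃-syntax; _×_; _,_)
open import Data.Sum using (inj₁; inj₂)
open import Function.Bundles using (_↔_; Inverse)
open import Relation.Binary.PropositionalEquality using (_≡_)

-- The family {A_i} is indexed by Fin m; each A_i is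
-- a multiset on Fin n given by its multiplicity function (0 = not in the
-- support).  The partial order on the family is a Boolean relation on
-- indices:  ord i j = true  means  A_i ⪯ A_j.

record Raw : Set where
  field
    n   : ℕ
    m   : ℕ
    fam : Fin m → Fin n → ℕ
    ord : Fin m → Fin m → Bool
open Raw public

IsSingleton : {n : ℕ} → Fin n → (Fin n → ℕ) → Set
IsSingleton {n} k f = ∀ k' → f k' ≡ (if isYes (k ≟ k') then 1 else 0)

record IsMultiComplex (R : Raw) : Set where
  private
    A : Fin (Raw.m R) → Fin (Raw.n R) → ℕ
    A = fam R
    ⪯ : Fin (Raw.m R) → Fin (Raw.m R) → Bool
    ⪯ = ord R
  field
    nonempty   : ∀ i → ∃[ k ] (0 < A i k)
    ord-refl   : ∀ i → T (⪯ i i)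
    ord-antisym : ∀ i j → T (⪯ i j) → T (⪯ j i) → i ≡ j
    ord-trans  : ∀ i j l → T (⪯ i j) → T (⪯ j l) → T (⪯ i l)
    singleton-unique : ∀ k → Σ (Fin (Raw.m R)) λ i →
                         IsSingleton k (A i) × (∀ j → IsSingleton k (A j) → j ≡ i)
    singleton-ord : ∀ k i j → IsSingleton k (A i) →
                      (T (⪯ i j) → 0 < A j k) × (0 < A j k → T (⪯ i j))
    ord-contained : ∀ i j → T (⪯ i j) → ∀ k → A i k ≤ A j k

record MultiComplex : Set where
  field
    raw  : Raw
    isMC : IsMultiComplex raw
open MultiComplex public

record _≅_ (R S : Raw) : Set where
  field
    σ : Fin (n R) ↔ Fin (n S)
    τ : Fin (m R) ↔ Fin (m S)
    fam-resp : ∀ i k → fam S (Inverse.to τ i) (Inverse.to σ k) ≡ fam R i k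
    ord-resp : ∀ i j → ord S (Inverse.to τ i) (Inverse.to τ j) ≡ ord R i j

data PathConnected (R : Raw) : Fin (n R) → Fin (n R) → Set where
  here : ∀ a → PathConnected R a a
  step : ∀ {a c b} (i : Fin (m R)) → 0 < fam R i a → 0 < fam R i c →
         PathConnected R c b → PathConnected R a b

Connected : MultiComplex → Set
Connected C = ∀ a b → PathConnected (raw C) a b

_⊔_ : Raw → Raw → Raw
R ⊔ S = record
  { n = n R ℕ.+ n S
  ; m = m R ℕ.+ m S
  ; fam = λ i k → famU (splitAt (m R) i) (splitAt (n R) k)
  ; ord = λ i j → ordU (splitAt (m R) i) (splitAt (m R) j)
  }
  where
  open import Data.Sum using (_⊎_)
  famU : Fin (m R) ⊎ Fin (m S) → Fin (n R) ⊎ Fin (n S) → ℕ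
  famU (inj₁ i) (inj₁ k) = fam R i k
  famU (inj₂ i) (inj₂ k) = fam S i k
  famU _ _ = 0
  ordU : Fin (m R) ⊎ Fin (m S) → Fin (m R) ⊎ Fin (m S) → Bool
  ordU (inj₁ i) (inj₁ j) = ord R i j
  ordU (inj₂ i) (inj₂ j) = ord S i j
  ordU _ _ = false

emptyRaw : Raw
emptyRaw = record { n = 0 ; m = 0 ; fam = λ () ; ord = λ () }

-- The algebra H_C with integer coefficients: formal finite Z-linear
-- combinations of multi-complexes, modulo the congruence generated by
-- reordering, merging terms with isomorphic multi-complexes, and dropping
-- zero terms.  This is exactly equality in the free Z-module on
-- isomorphism classes.

HC : Set
HC = List (ℤ × Raw)

infix 4 _∼_
data _∼_ : HC → HC → Set where
  ∼-refl  : ∀ {L} → L ∼ L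
  ∼-sym   : ∀ {L L'} → L ∼ L' → L' ∼ L
  ∼-trans : ∀ {L L' L''} → L ∼ L' → L' ∼ L'' → L ∼ L''
  ∼-cons  : ∀ {x L L'} → L ∼ L' → (x ∷ L) ∼ (x ∷ L')
  ∼-swap  : ∀ {x y L} → (x ∷ y ∷ L) ∼ (y ∷ x ∷ L)
  ∼-merge : ∀ {c d X Y L} → X ≅ Y → ((c , X) ∷ (d , Y) ∷ L) ∼ ((c ℤ.+ d , X) ∷ L)
  ∼-zero  : ∀ {X L} → ((0ℤ , X) ∷ L) ∼ L

basis : Raw → HC
basis X = (1ℤ , X) ∷ []

oneH : HC
oneH = basis emptyRaw

_*H_ : HC → HC → HC
L *H L' = concatMap (λ { (c , X) → map (λ { (d , Y) → (c ℤ.* d , X ⊔ Y) }) L' }) L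

_·H_ : ℕ → HC → HC
k ·H L = map (λ { (c , X) → (ℤ.+ k ℤ.* c , X) }) L

-- Sub-multi-complexes D ⪯ C: downward closed subfamilies containing every
-- singleton (so that n_D = n_C), encoded as subsets of the index set Fin m.

Subset : ℕ → Set
Subset m = Vec Bool m

allSubsets : (m : ℕ) → List (Subset m)
allSubsets zero    = [] ∷ []
allSubsets (suc m) = map (true ∷_) (allSubsets m) ++ map (false ∷_) (allSubsets m)

isSingletonᵇ : {n : ℕ} → (Fin n → ℕ) → Bool
isSingletonᵇ {n} f = sum (map f (allFin n)) ≡ᵇ 1

_⇒ᵇ_ : Bool → Bool → Bool
a ⇒ᵇ b = not a ∨ b

allᵇ : {A : Set} → (A → Bool) → List A → Bool
allᵇ p xs = and (map p xs)

isSubᵇ : (R : Raw) → Subset (m R) → Bool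
isSubᵇ R S =
  allᵇ (λ i → allᵇ (λ j → (Vec.lookup S j ∧ ord R i j) ⇒ᵇ Vec.lookup S i) (allFin (m R))) (allFin (m R))
  ∧ allᵇ (λ i → isSingletonᵇ (fam R i) ⇒ᵇ Vec.lookup S i) (allFin (m R))

X : (R : Raw) → List (Subset (m R))
X R = filterᵇ (isSubᵇ R) (allSubsets (m R))

_⊆ᵇ_ : {m : ℕ} → Subset m → Subset m → Bool
[] ⊆ᵇ [] = true
(a ∷ S) ⊆ᵇ (b ∷ S') = (a ⇒ᵇ b) ∧ (S ⊆ᵇ S')

_==ᵇ_ : {m : ℕ} → Subset m → Subset m → Bool
S ==ᵇ S' = (S ⊆ᵇ S') ∧ (S' ⊆ᵇ S)

full : (m : ℕ) → Subset m
full m = Vec.replicate m true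

-- Möbius function of X_C, via the standard recursion
--   μ(D,D) = 1,  μ(D,E) = - Σ_{D ≤ F < E} μ(D,F) for D < E,  0 otherwise,
-- with a fuel argument (fuel suc (m R) is always sufficient since strict
-- chains in X_C have length at most m R).
μ-fuel : (R : Raw) → ℕ → Subset (m R) → Subset (m R) → ℤ
μ-fuel R zero    D E = 0ℤ
μ-fuel R (suc f) D E =
  if D ==ᵇ E then 1ℤ
  else if D ⊆ᵇ E then
    ℤ.- foldr ℤ._+_ 0ℤ
          (map (μ-fuel R f D)
               (filterᵇ (λ F → (D ⊆ᵇ F) ∧ (F ⊆ᵇ E) ∧ not (F ==ᵇ E)) (X R)))
  else 0ℤ

μP : (R : Raw) → Subset (m R) → Subset (m R) → ℤ
μP R = μ-fuel R (suc (m R))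

restrict : (R : Raw) → Subset (m R) → Raw
restrict R S = record
  { n = n R
  ; m = length sel
  ; fam = λ i → fam R (lookup sel i)
  ; ord = λ i j → ord R (lookup sel i) (lookup sel j)
  }
  where
  sel : List (Fin (m R))
  sel = filterᵇ (Vec.lookup S) (allFin (m R))

P : Raw → HC
P R = map (λ S → (μP R S (full (m R)) , restrict R S)) (X R)

-- Polynomials with non-negative integer coefficients in the P_D, D connected:
-- a list of monomials, each a coefficient in ℕ and a list of connected
-- multi-complexes (the factors, with repetition).

ConnectedMC : Set
ConnectedMC = Σ MultiComplex Connected

Poly : Set
Poly = List (ℕ × List ConnectedMC)

evalMonomial : List ConnectedMC → HC
evalMonomial = foldr (λ { (D , _) acc → P (raw D) *H acc }) oneH

evalPoly : Poly → HC
evalPoly = foldr (λ { (k , mon) acc → (k ·H evalMonomial mon) ++ acc }) []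

-- Möbius inversion over the poset X_C gives [C] = Σ_{D ⪯ C} P_D, because
-- Σ_{E ⪯ D ⪯ C} μ(E, D) = δ(E, C) and the sub-multi-complexes of D ⪯ C are
-- those of C contained in D.  The map D ↦ P_D respects isomorphism and is
-- multiplicative, P_{A ⊔ B} = P_A P_B: the poset X_{A ⊔ B} is the product
-- X_A × X_B, and the Möbius function of a product of posets is the product of
-- the Möbius functions.  Every multi-complex is the disjoint union of its
-- connected components, so each P_D is a monomial in the P's of connected
-- multi-complexes, and [C] is a sum of such monomials with coefficient 1.

module Submission where

open import Defs
import Algebra.Bundles
open import Data.Product using (Σ; ∃-syntax; _×_; _,_; proj₁; proj₂)
open import Data.Sum as Sum using (_⊎_; inj₁; inj₂)
open import Data.Sum.Function.Propositional using (_⊎-↔_)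
open import Data.Nat as ℕ using (ℕ; zero; suc; _≤_; _<_; z≤n; s≤s)
import Data.Nat.Properties as ℕP
open import Data.Nat.ListAction using (sum)
import Data.Nat.ListAction.Properties as ℕLP
open import Data.Integer as ℤ using (ℤ; 0ℤ; 1ℤ)
import Data.Integer.Properties as ℤP
open import Data.Fin as F using (Fin; splitAt; join; _↑ˡ_; _↑ʳ_; _≟_)
import Data.Fin.Properties as FP
open import Data.Bool using (Bool; true; false; _∧_; _∨_; not; if_then_else_; T)
import Data.Bool.Properties as BP
open import Data.Bool.ListAction using (any)
open import Data.Unit using (tt)
open import Data.Empty using (⊥; ⊥-elim)
open import Data.List using (List; []; _∷_; map; _++_; concatMap; concat; foldr; filterᵇ; length; lookup; allFin; cartesianProductWith)
import Data.List.Properties as LP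
open import Data.List.Membership.Propositional using (_∈_)
open import Data.List.Membership.Propositional.Properties
  using (∈-map⁺; ∈-map⁻; ∈-filter⁺; ∈-filter⁻; ∈-++⁺ˡ; ∈-++⁺ʳ; ∈-allFin; ∈-lookup; ∈-cartesianProductWith⁺; ∈-cartesianProductWith⁻)
open import Data.List.Membership.Propositional.Properties.WithK using (unique∧set⇒bag)
open import Data.List.Relation.Unary.Any using (here; there; index)
open import Data.List.Relation.Unary.Any.Properties using (lookup-index)
import Data.List.Relation.Unary.All as All
open import Data.List.Relation.Unary.Unique.Propositional using (Unique; []; _∷_)
import Data.List.Relation.Unary.Unique.Propositional.Properties as Unique
open import Data.List.Relation.Binary.Pointwise using (Pointwise; []; _∷_)
open import Data.List.Relation.Binary.BagAndSetEquality using (∼bag⇒↭)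
import Data.List.Relation.Binary.Permutation.Propositional as Perm
open Perm using (_↭_)
import Data.List.Relation.Binary.Permutation.Propositional.Properties as PermP
open import Data.Vec as Vec using (Vec; []; _∷_)
import Data.Vec.Properties as VP
open import Relation.Nullary using (¬_; Dec)
open import Relation.Nullary.Decidable using (isYes; yes; no; T?; isYes≗does; dec-true; dec-false; toWitness)
open import Relation.Binary.PropositionalEquality
  using (_≡_; _≢_; refl; sym; trans; cong; cong₂; subst; subst₂; module ≡-Reasoning)
open import Relation.Binary.Bundles using (Setoid)
import Relation.Binary.Reasoning.Setoid as SetoidReasoning
open import Function using (_∘_; id; const)
open import Function.Bundles using (_↔_; Inverse; Injection; mk↔ₛ′; mk⇔)
open import Function.Properties.Inverse using (↔-refl; ↔-sym; ↔-trans; ↔⇒↣)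
open import Algebra.Properties.CommutativeSemigroup
  (Algebra.Bundles.CommutativeMonoid.commutativeSemigroup BP.∧-commutativeMonoid)
  using () renaming (interchange to ∧-interchange)
open import Algebra.Properties.AbelianGroup ℤP.+-0-abelianGroup
  using () renaming (inverseˡ-unique to +-inverseˡ-unique)

private variable
  A B C : Set

bool-cases : ∀ {P : Set} (b : Bool) → (b ≡ true → P) → (b ≡ false → P) → P
bool-cases true  t f = t refl
bool-cases false t f = f refl

bool-ext : ∀ {a b : Bool} → (a ≡ true → b ≡ true) → (b ≡ true → a ≡ true) → a ≡ b
bool-ext {false} {false} f g = refl
bool-ext {false} {true}  f g = g refl
bool-ext {true}  {false} f g = sym (f refl)
bool-ext {true}  {true}  f g = refl

true≢false : true ≢ false
true≢false ()

∧≡true⁻ : ∀ {a b} → a ∧ b ≡ true → a ≡ true × b ≡ true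
∧≡true⁻ {true} {true} refl = refl , refl

∧≡true⁺ : ∀ {a b} → a ≡ true → b ≡ true → a ∧ b ≡ true
∧≡true⁺ refl refl = refl

∨≡true⁺ˡ : ∀ {a b} → a ≡ true → a ∨ b ≡ true
∨≡true⁺ˡ refl = refl

∨≡true⁺ʳ : ∀ {a b} → b ≡ true → a ∨ b ≡ true
∨≡true⁺ʳ {true}  _ = refl
∨≡true⁺ʳ {false} h = h

not≡true⁻ : ∀ {a} → not a ≡ true → a ≡ false
not≡true⁻ {false} _ = refl

⇒ᵇ≡true⁻ : ∀ {a b} → (a ⇒ᵇ b) ≡ true → a ≡ true → b ≡ true
⇒ᵇ≡true⁻ {true} {true} _ _ = refl

⇒ᵇ≡true⁺ : ∀ {a b} → (a ≡ true → b ≡ true) → (a ⇒ᵇ b) ≡ true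
⇒ᵇ≡true⁺ {false} f = refl
⇒ᵇ≡true⁺ {true}  f = f refl

⇒ᵇ≡false⁻ : ∀ {a b} → (a ⇒ᵇ b) ≡ false → a ≡ true × b ≡ false
⇒ᵇ≡false⁻ {true} {false} _ = refl , refl

≡true⇒T : ∀ {b} → b ≡ true → T b
≡true⇒T refl = tt

T⇒≡true : ∀ {b} → T b → b ≡ true
T⇒≡true {true} _ = refl

ifᵈ : (b : Bool) → (b ≡ true → Bool) → Bool
ifᵈ true  f = f refl
ifᵈ false f = false

ifᵈ-true : ∀ b (f : b ≡ true → Bool) (p : b ≡ true) → ifᵈ b f ≡ f p
ifᵈ-true true f refl = refl

ifᵈ-false : ∀ b (f : b ≡ true → Bool) → b ≡ false → ifᵈ b f ≡ false
ifᵈ-false false f refl = refl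

allᵇ≡true⁻ : ∀ (p : A → Bool) xs → allᵇ p xs ≡ true → ∀ x → x ∈ xs → p x ≡ true
allᵇ≡true⁻ p (y ∷ ys) h x (here refl) = proj₁ (∧≡true⁻ h)
allᵇ≡true⁻ p (y ∷ ys) h x (there m)   = allᵇ≡true⁻ p ys (proj₂ (∧≡true⁻ {p y} h)) x m

allᵇ≡true⁺ : ∀ (p : A → Bool) xs → (∀ x → x ∈ xs → p x ≡ true) → allᵇ p xs ≡ true
allᵇ≡true⁺ p []       h = refl
allᵇ≡true⁺ p (y ∷ ys) h = ∧≡true⁺ (h y (here refl)) (allᵇ≡true⁺ p ys (λ x m → h x (there m)))

allᵇ≡false⁻ : ∀ (p : A → Bool) xs → allᵇ p xs ≡ false → ∃[ x ] (x ∈ xs × p x ≡ false)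
allᵇ≡false⁻ p (x ∷ xs) h with p x in e
... | false = x , here refl , e
... | true  = let y , m , q = allᵇ≡false⁻ p xs h in y , there m , q

allFinᵇ≡true⁻ : ∀ {n} (p : Fin n → Bool) → allᵇ p (allFin n) ≡ true → ∀ i → p i ≡ true
allFinᵇ≡true⁻ p h i = allᵇ≡true⁻ p _ h i (∈-allFin i)

allFinᵇ≡true⁺ : ∀ {n} (p : Fin n → Bool) → (∀ i → p i ≡ true) → allᵇ p (allFin n) ≡ true
allFinᵇ≡true⁺ {n} p h = allᵇ≡true⁺ p (allFin n) (λ x _ → h x)

any≡true⁻ : ∀ (p : A → Bool) xs → any p xs ≡ true → ∃[ x ] (x ∈ xs × p x ≡ true)
any≡true⁻ p (x ∷ xs) h with p x in e
... | true  = x , here refl , e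
... | false = let y , m , q = any≡true⁻ p xs h in y , there m , q

any≡true⁺ : ∀ (p : A → Bool) {xs} x → x ∈ xs → p x ≡ true → any p xs ≡ true
any≡true⁺ p {y ∷ xs} x (here refl) q = ∨≡true⁺ˡ q
any≡true⁺ p {y ∷ xs} x (there m)   q = ∨≡true⁺ʳ {p y} (any≡true⁺ p x m q)

any-cong : ∀ (p q : A → Bool) xs → (∀ x → p x ≡ q x) → any p xs ≡ any q xs
any-cong p q []       h = refl
any-cong p q (x ∷ xs) h = cong₂ _∨_ (h x) (any-cong p q xs h)

∈-filterᵇ⁺ : ∀ (p : A → Bool) {x xs} → x ∈ xs → p x ≡ true → x ∈ filterᵇ p xs
∈-filterᵇ⁺ p x∈ px = ∈-filter⁺ (T? ∘ p) x∈ (≡true⇒T px)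

∈-filterᵇ⁻ : ∀ (p : A → Bool) {x} xs → x ∈ filterᵇ p xs → x ∈ xs × p x ≡ true
∈-filterᵇ⁻ p xs x∈ = let x∈xs , px = ∈-filter⁻ (T? ∘ p) {xs = xs} x∈ in x∈xs , T⇒≡true px

map-cong-∈ : ∀ {f g : A → B} xs → (∀ x → x ∈ xs → f x ≡ g x) → map f xs ≡ map g xs
map-cong-∈ []       h = refl
map-cong-∈ (x ∷ xs) h = cong₂ _∷_ (h x (here refl)) (map-cong-∈ xs (λ y m → h y (there m)))

filterᵇ-cong-∈ : ∀ {p q : A → Bool} xs → (∀ x → x ∈ xs → p x ≡ q x) → filterᵇ p xs ≡ filterᵇ q xs
filterᵇ-cong-∈ [] h = refl
filterᵇ-cong-∈ {p = p} {q} (x ∷ xs) h with p x in e₁ | q x in e₂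
... | true  | true  = cong (x ∷_) (filterᵇ-cong-∈ xs (λ y m → h y (there m)))
... | false | false = filterᵇ-cong-∈ xs (λ y m → h y (there m))
... | true  | false = ⊥-elim (true≢false (trans (sym e₁) (trans (h x (here refl)) e₂)))
... | false | true  = ⊥-elim (true≢false (trans (sym e₂) (trans (sym (h x (here refl))) e₁)))

filterᵇ-none : ∀ (p : A → Bool) xs → (∀ x → x ∈ xs → p x ≡ false) → filterᵇ p xs ≡ []
filterᵇ-none p xs h = trans (filterᵇ-cong-∈ xs h) (LP.filter-none (T? ∘ const false) {xs} (All.tabulate λ _ ()))

filterᵇ-all : ∀ (p : A → Bool) xs → (∀ x → x ∈ xs → p x ≡ true) → filterᵇ p xs ≡ xs
filterᵇ-all p xs h = trans (filterᵇ-cong-∈ xs h) (LP.filter-all (T? ∘ const true) {xs} (All.tabulate λ _ → tt))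

filterᵇ-map : ∀ (p : B → Bool) (f : A → B) xs → filterᵇ p (map f xs) ≡ map f (filterᵇ (p ∘ f) xs)
filterᵇ-map p f []       = refl
filterᵇ-map p f (x ∷ xs) with p (f x)
... | true  = cong (f x ∷_) (filterᵇ-map p f xs)
... | false = filterᵇ-map p f xs

filterᵇ-filterᵇ : ∀ (p q : A → Bool) xs → filterᵇ p (filterᵇ q xs) ≡ filterᵇ (λ x → q x ∧ p x) xs
filterᵇ-filterᵇ p q [] = refl
filterᵇ-filterᵇ p q (x ∷ xs) with q x
... | false = filterᵇ-filterᵇ p q xs
... | true with p x
...   | true  = cong (x ∷_) (filterᵇ-filterᵇ p q xs)
...   | false = filterᵇ-filterᵇ p q xs

filterᵇ-↭ : ∀ (p : A → Bool) {xs ys} → xs ↭ ys → filterᵇ p xs ↭ filterᵇ p ys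
filterᵇ-↭ p = PermP.filter-↭ (T? ∘ p)

filterᵇ-partition : ∀ (p q : A → Bool) xs →
  filterᵇ p xs ↭ filterᵇ (λ x → p x ∧ q x) xs ++ filterᵇ (λ x → p x ∧ not (q x)) xs
filterᵇ-partition p q [] = Perm.refl
filterᵇ-partition p q (x ∷ xs) with p x | q x
... | false | _     = filterᵇ-partition p q xs
... | true  | true  = Perm.prep x (filterᵇ-partition p q xs)
... | true  | false = Perm.trans (Perm.prep x (filterᵇ-partition p q xs))
                        (Perm.↭-sym (PermP.shift x (filterᵇ (λ x → p x ∧ q x) xs) _))

length-filterᵇ-mono : ∀ (p q : A → Bool) xs → (∀ x → p x ≡ true → q x ≡ true) →
  length (filterᵇ p xs) ≤ length (filterᵇ q xs)
length-filterᵇ-mono p q [] h = z≤n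
length-filterᵇ-mono p q (x ∷ xs) h with p x in e₁ | q x in e₂
... | true  | true  = s≤s (length-filterᵇ-mono p q xs h)
... | false | true  = ℕP.m≤n⇒m≤1+n (length-filterᵇ-mono p q xs h)
... | false | false = length-filterᵇ-mono p q xs h
... | true  | false with () ← trans (sym (h x e₁)) e₂

length-filterᵇ-strict : ∀ (p q : A → Bool) xs → (∀ x → p x ≡ true → q x ≡ true) →
  ∀ y → y ∈ xs → q y ≡ true → p y ≡ false → length (filterᵇ p xs) < length (filterᵇ q xs)
length-filterᵇ-strict p q (x ∷ xs) h y (here refl) qy py rewrite qy | py = s≤s (length-filterᵇ-mono p q xs h)
length-filterᵇ-strict p q (x ∷ xs) h y (there mem) qy py with p x in e₁ | q x in e₂
... | true  | true  = s≤s (length-filterᵇ-strict p q xs h y mem qy py)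
... | false | true  = ℕP.m≤n⇒m≤1+n (length-filterᵇ-strict p q xs h y mem qy py)
... | false | false = length-filterᵇ-strict p q xs h y mem qy py
... | true  | false with () ← trans (sym (h x e₁)) e₂

unique-filterᵇ : ∀ (p : A → Bool) {xs} → Unique xs → Unique (filterᵇ p xs)
unique-filterᵇ p = Unique.filter⁺ (T? ∘ p)

unique∧same-elements⇒↭ : {xs ys : List A} → Unique xs → Unique ys →
  (∀ {z} → z ∈ xs → z ∈ ys) → (∀ {z} → z ∈ ys → z ∈ xs) → xs ↭ ys
unique∧same-elements⇒↭ u v f g = ∼bag⇒↭ (unique∧set⇒bag u v (mk⇔ f g))

lookup-injective : ∀ {xs : List A} → Unique xs → ∀ i j → lookup xs i ≡ lookup xs j → i ≡ j
lookup-injective (h ∷ u) F.zero    F.zero    e = refl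
lookup-injective (h ∷ u) F.zero    (F.suc j) e = ⊥-elim (All.lookup h (∈-lookup j) e)
lookup-injective (h ∷ u) (F.suc i) F.zero    e = ⊥-elim (All.lookup h (∈-lookup i) (sym e))
lookup-injective (h ∷ u) (F.suc i) (F.suc j) e = cong F.suc (lookup-injective u i j e)

concatMap-++-↭ : ∀ (f g : A → List B) xs → concatMap (λ x → f x ++ g x) xs ↭ concatMap f xs ++ concatMap g xs
concatMap-++-↭ f g []       = Perm.refl
concatMap-++-↭ f g (x ∷ xs) =
  Perm.trans (Perm.↭-reflexive (LP.++-assoc (f x) (g x) _))
   (Perm.trans (PermP.++⁺ˡ (f x) (Perm.trans (PermP.++⁺ˡ (g x) (concatMap-++-↭ f g xs))
                                             (PermP.shifts (g x) (concatMap f xs))))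
     (Perm.↭-reflexive (sym (LP.++-assoc (f x) (concatMap f xs) _))))

concatMap-[] : ∀ (xs : List A) → concatMap (λ _ → [] {A = B}) xs ≡ []
concatMap-[] []       = refl
concatMap-[] (x ∷ xs) = concatMap-[] xs

concatMap-comm : ∀ (k : A → B → List C) xs ys →
  concatMap (λ a → concatMap (k a) ys) xs ↭ concatMap (λ b → concatMap (λ a → k a b) xs) ys
concatMap-comm k []       ys = Perm.↭-reflexive (sym (concatMap-[] ys))
concatMap-comm k (x ∷ xs) ys =
  Perm.trans (PermP.++⁺ˡ (concatMap (k x) ys) (concatMap-comm k xs ys))
    (Perm.↭-sym (concatMap-++-↭ (k x) (λ b → concatMap (λ a → k a b) xs) ys))

map-filterᵇ≡concatMap : ∀ (f : A → B) (p : A → Bool) xs →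
  map f (filterᵇ p xs) ≡ concatMap (λ y → if p y then f y ∷ [] else []) xs
map-filterᵇ≡concatMap f p []       = refl
map-filterᵇ≡concatMap f p (x ∷ xs) with p x
... | true  = cong (f x ∷_) (map-filterᵇ≡concatMap f p xs)
... | false = map-filterᵇ≡concatMap f p xs

concatMap-filterᵇ-comm : ∀ (h : A → A → C) (r : A → A → Bool) xs →
  concatMap (λ s → map (λ t → h t s) (filterᵇ (λ t → r t s) xs)) xs ↭
  concatMap (λ t → map (h t) (filterᵇ (r t) xs)) xs
concatMap-filterᵇ-comm h r xs =
  Perm.trans (Perm.↭-reflexive (LP.concatMap-cong (λ s → map-filterᵇ≡concatMap (λ t → h t s) (λ t → r t s) xs) xs))
    (Perm.trans (concatMap-comm (λ s t → if r t s then h t s ∷ [] else []) xs xs)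
      (Perm.↭-reflexive (sym (LP.concatMap-cong (λ t → map-filterᵇ≡concatMap (h t) (r t) xs) xs))))

map-cartesianProductWith : ∀ {D : Set} (h : C → D) (f : A → B → C) xs ys →
  map h (cartesianProductWith f xs ys) ≡ concatMap (λ x → map (λ y → h (f x y)) ys) xs
map-cartesianProductWith h f []       ys = refl
map-cartesianProductWith h f (x ∷ xs) ys =
  trans (LP.map-++ h (map (f x) ys) _)
        (cong₂ _++_ (sym (LP.map-∘ ys)) (map-cartesianProductWith h f xs ys))

≅-refl : ∀ {R} → R ≅ R
≅-refl = record { σ = ↔-refl ; τ = ↔-refl ; fam-resp = λ _ _ → refl ; ord-resp = λ _ _ → refl }

≅-sym : ∀ {R S} → R ≅ S → S ≅ R
≅-sym {R} {S} I = record { σ = ↔-sym σ ; τ = ↔-sym τ ; fam-resp = fam-resp′ ; ord-resp = ord-resp′ }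
  where
  open _≅_ I
  open Inverse
  fam-resp′ : ∀ i k → fam R (from τ i) (from σ k) ≡ fam S i k
  fam-resp′ i k = trans (sym (fam-resp (from τ i) (from σ k)))
                        (cong₂ (fam S) (strictlyInverseˡ τ i) (strictlyInverseˡ σ k))
  ord-resp′ : ∀ i j → ord R (from τ i) (from τ j) ≡ ord S i j
  ord-resp′ i j = trans (sym (ord-resp (from τ i) (from τ j)))
                        (cong₂ (ord S) (strictlyInverseˡ τ i) (strictlyInverseˡ τ j))

≅-trans : ∀ {R S U} → R ≅ S → S ≅ U → R ≅ U
≅-trans I J = record
  { σ = ↔-trans (_≅_.σ I) (_≅_.σ J) ; τ = ↔-trans (_≅_.τ I) (_≅_.τ J)
  ; fam-resp = λ i k → trans (_≅_.fam-resp J _ _) (_≅_.fam-resp I i k)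
  ; ord-resp = λ i j → trans (_≅_.ord-resp J _ _) (_≅_.ord-resp I i j) }

↔-from-same-image : ∀ {a b} (ι₁ : Fin a → C) (ι₂ : Fin b → C) →
  (∀ i j → ι₁ i ≡ ι₁ j → i ≡ j) → (∀ i j → ι₂ i ≡ ι₂ j → i ≡ j) →
  (f : Fin a → Fin b) → (∀ i → ι₂ (f i) ≡ ι₁ i) →
  (g : Fin b → Fin a) → (∀ j → ι₁ (g j) ≡ ι₂ j) → Fin a ↔ Fin b
↔-from-same-image ι₁ ι₂ ι₁-inj ι₂-inj f f-ok g g-ok =
  mk↔ₛ′ f g (λ y → ι₂-inj _ _ (trans (f-ok (g y)) (g-ok y)))
            (λ x → ι₁-inj _ _ (trans (g-ok (f x)) (f-ok x)))

data SplitView (a b : ℕ) : Fin (a ℕ.+ b) → Set where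
  left  : (i : Fin a) → SplitView a b (i ↑ˡ b)
  right : (j : Fin b) → SplitView a b (a ↑ʳ j)

splitView : ∀ a b (i : Fin (a ℕ.+ b)) → SplitView a b i
splitView a b i with splitAt a i in eq
... | inj₁ j = subst (SplitView a b) (FP.splitAt⁻¹-↑ˡ eq) (left j)
... | inj₂ j = subst (SplitView a b) (FP.splitAt⁻¹-↑ʳ eq) (right j)

↑ˡ≢↑ʳ : ∀ {a b} (i : Fin a) (j : Fin b) → i ↑ˡ b ≢ a ↑ʳ j
↑ˡ≢↑ʳ {a} {b} i j e
  with () ← trans (sym (FP.splitAt-↑ˡ a i b)) (trans (cong (splitAt a) e) (FP.splitAt-↑ʳ a b j))

module _ (A B : Raw) where

  fam-⊔ˡˡ : ∀ i k → fam (A ⊔ B) (i ↑ˡ m B) (k ↑ˡ n B) ≡ fam A i k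
  fam-⊔ˡˡ i k rewrite FP.splitAt-↑ˡ (m A) i (m B) | FP.splitAt-↑ˡ (n A) k (n B) = refl

  fam-⊔ˡʳ : ∀ i k → fam (A ⊔ B) (i ↑ˡ m B) (n A ↑ʳ k) ≡ 0
  fam-⊔ˡʳ i k rewrite FP.splitAt-↑ˡ (m A) i (m B) | FP.splitAt-↑ʳ (n A) (n B) k = refl

  fam-⊔ʳˡ : ∀ i k → fam (A ⊔ B) (m A ↑ʳ i) (k ↑ˡ n B) ≡ 0
  fam-⊔ʳˡ i k rewrite FP.splitAt-↑ʳ (m A) (m B) i | FP.splitAt-↑ˡ (n A) k (n B) = refl

  fam-⊔ʳʳ : ∀ i k → fam (A ⊔ B) (m A ↑ʳ i) (n A ↑ʳ k) ≡ fam B i k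
  fam-⊔ʳʳ i k rewrite FP.splitAt-↑ʳ (m A) (m B) i | FP.splitAt-↑ʳ (n A) (n B) k = refl

  ord-⊔ˡˡ : ∀ i j → ord (A ⊔ B) (i ↑ˡ m B) (j ↑ˡ m B) ≡ ord A i j
  ord-⊔ˡˡ i j rewrite FP.splitAt-↑ˡ (m A) i (m B) | FP.splitAt-↑ˡ (m A) j (m B) = refl

  ord-⊔ˡʳ : ∀ i j → ord (A ⊔ B) (i ↑ˡ m B) (m A ↑ʳ j) ≡ false
  ord-⊔ˡʳ i j rewrite FP.splitAt-↑ˡ (m A) i (m B) | FP.splitAt-↑ʳ (m A) (m B) j = refl

  ord-⊔ʳˡ : ∀ i j → ord (A ⊔ B) (m A ↑ʳ i) (j ↑ˡ m B) ≡ false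
  ord-⊔ʳˡ i j rewrite FP.splitAt-↑ʳ (m A) (m B) i | FP.splitAt-↑ˡ (m A) j (m B) = refl

  ord-⊔ʳʳ : ∀ i j → ord (A ⊔ B) (m A ↑ʳ i) (m A ↑ʳ j) ≡ ord B i j
  ord-⊔ʳʳ i j rewrite FP.splitAt-↑ʳ (m A) (m B) i | FP.splitAt-↑ʳ (m A) (m B) j = refl

+-↔ : ∀ {a b a' b'} → Fin a ↔ Fin a' → Fin b ↔ Fin b' → Fin (a ℕ.+ b) ↔ Fin (a' ℕ.+ b')
+-↔ f g = ↔-trans FP.+↔⊎ (↔-trans (f ⊎-↔ g) (↔-sym FP.+↔⊎))

⊔-cong : ∀ {X X' Y Y'} → X ≅ X' → Y ≅ Y' → (X ⊔ Y) ≅ (X' ⊔ Y')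
⊔-cong {X} {X'} {Y} {Y'} I J = record
  { σ = +-↔ (σ I) (σ J) ; τ = +-↔ (τ I) (τ J) ; fam-resp = fam-resp′ ; ord-resp = ord-resp′ }
  where
  open _≅_
  open Inverse
  fam-resp′ : ∀ i k → fam (X' ⊔ Y') (to (+-↔ (τ I) (τ J)) i) (to (+-↔ (σ I) (σ J)) k) ≡ fam (X ⊔ Y) i k
  fam-resp′ i k with splitView (m X) (m Y) i | splitView (n X) (n Y) k
  ... | left i' | left k' rewrite FP.splitAt-↑ˡ (m X) i' (m Y) | FP.splitAt-↑ˡ (n X) k' (n Y)
        = trans (fam-⊔ˡˡ X' Y' _ _) (fam-resp I i' k')
  ... | left i' | right k' rewrite FP.splitAt-↑ˡ (m X) i' (m Y) | FP.splitAt-↑ʳ (n X) (n Y) k'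
        = fam-⊔ˡʳ X' Y' _ _
  ... | right i' | left k' rewrite FP.splitAt-↑ʳ (m X) (m Y) i' | FP.splitAt-↑ˡ (n X) k' (n Y)
        = fam-⊔ʳˡ X' Y' _ _
  ... | right i' | right k' rewrite FP.splitAt-↑ʳ (m X) (m Y) i' | FP.splitAt-↑ʳ (n X) (n Y) k'
        = trans (fam-⊔ʳʳ X' Y' _ _) (fam-resp J i' k')
  ord-resp′ : ∀ i j → ord (X' ⊔ Y') (to (+-↔ (τ I) (τ J)) i) (to (+-↔ (τ I) (τ J)) j) ≡ ord (X ⊔ Y) i j
  ord-resp′ i j with splitView (m X) (m Y) i | splitView (m X) (m Y) j
  ... | left i' | left j' rewrite FP.splitAt-↑ˡ (m X) i' (m Y) | FP.splitAt-↑ˡ (m X) j' (m Y)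
        = trans (ord-⊔ˡˡ X' Y' _ _) (ord-resp I i' j')
  ... | left i' | right j' rewrite FP.splitAt-↑ˡ (m X) i' (m Y) | FP.splitAt-↑ʳ (m X) (m Y) j'
        = ord-⊔ˡʳ X' Y' _ _
  ... | right i' | left j' rewrite FP.splitAt-↑ʳ (m X) (m Y) i' | FP.splitAt-↑ˡ (m X) j' (m Y)
        = ord-⊔ʳˡ X' Y' _ _
  ... | right i' | right j' rewrite FP.splitAt-↑ʳ (m X) (m Y) i' | FP.splitAt-↑ʳ (m X) (m Y) j'
        = trans (ord-⊔ʳʳ X' Y' _ _) (ord-resp J i' j')

∼-setoid : Setoid _ _
∼-setoid = record { Carrier = HC ; _≈_ = _∼_
                  ; isEquivalence = record { refl = ∼-refl ; sym = ∼-sym ; trans = ∼-trans } }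

module ∼-Reasoning = SetoidReasoning ∼-setoid

sumℤ : List ℤ → ℤ
sumℤ = foldr ℤ._+_ 0ℤ

sumℤ-++ : ∀ xs ys → sumℤ (xs ++ ys) ≡ sumℤ xs ℤ.+ sumℤ ys
sumℤ-++ []       ys = sym (ℤP.+-identityˡ _)
sumℤ-++ (x ∷ xs) ys = trans (cong (λ s → x ℤ.+ s) (sumℤ-++ xs ys)) (sym (ℤP.+-assoc x _ _))

sumℤ-↭ : ∀ {xs ys} → xs ↭ ys → sumℤ xs ≡ sumℤ ys
sumℤ-↭ Perm.refl         = refl
sumℤ-↭ (Perm.prep x r)   = cong (λ s → x ℤ.+ s) (sumℤ-↭ r)
sumℤ-↭ (Perm.swap x y r) = trans (sym (ℤP.+-assoc x y _))
  (trans (cong₂ ℤ._+_ (ℤP.+-comm x y) (sumℤ-↭ r)) (ℤP.+-assoc y x _))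
sumℤ-↭ (Perm.trans r s)  = trans (sumℤ-↭ r) (sumℤ-↭ s)

sumℤ-map-* : ∀ (c : ℤ) xs → sumℤ (map (c ℤ.*_) xs) ≡ c ℤ.* sumℤ xs
sumℤ-map-* c []       = sym (ℤP.*-zeroʳ c)
sumℤ-map-* c (x ∷ xs) = trans (cong (λ s → c ℤ.* x ℤ.+ s) (sumℤ-map-* c xs)) (sym (ℤP.*-distribˡ-+ c x _))

↭⇒∼ : ∀ {L L' : HC} → L ↭ L' → L ∼ L'
↭⇒∼ Perm.refl         = ∼-refl
↭⇒∼ (Perm.prep x r)   = ∼-cons (↭⇒∼ r)
↭⇒∼ (Perm.swap x y r) = ∼-trans ∼-swap (∼-cons (∼-cons (↭⇒∼ r)))
↭⇒∼ (Perm.trans r s)  = ∼-trans (↭⇒∼ r) (↭⇒∼ s)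

≡⇒∼ : ∀ {L L' : HC} → L ≡ L' → L ∼ L'
≡⇒∼ refl = ∼-refl

∼-coeff : ∀ {c c' X L} → c ≡ c' → ((c , X) ∷ L) ∼ ((c' , X) ∷ L)
∼-coeff refl = ∼-refl

∼-iso : ∀ {c X Y L} → X ≅ Y → ((c , X) ∷ L) ∼ ((c , Y) ∷ L)
∼-iso {c} I = ∼-trans (∼-sym ∼-zero) (∼-trans (∼-merge (≅-sym I)) (∼-coeff (ℤP.+-identityˡ c)))

++-congˡ : ∀ {L L' : HC} M → L ∼ L' → (L ++ M) ∼ (L' ++ M)
++-congˡ M ∼-refl        = ∼-refl
++-congˡ M (∼-sym r)     = ∼-sym (++-congˡ M r)
++-congˡ M (∼-trans r s) = ∼-trans (++-congˡ M r) (++-congˡ M s)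
++-congˡ M (∼-cons r)    = ∼-cons (++-congˡ M r)
++-congˡ M ∼-swap        = ∼-swap
++-congˡ M (∼-merge I)   = ∼-merge I
++-congˡ M ∼-zero        = ∼-zero

++-congʳ : ∀ (L : HC) {M M'} → M ∼ M' → (L ++ M) ∼ (L ++ M')
++-congʳ []      r = r
++-congʳ (x ∷ L) r = ∼-cons (++-congʳ L r)

++-cong : ∀ {L L' M M' : HC} → L ∼ L' → M ∼ M' → (L ++ M) ∼ (L' ++ M')
++-cong {L' = L'} {M} r s = ∼-trans (++-congˡ M r) (++-congʳ L' s)

concatMap-cong-∼ : ∀ (f g : A → HC) xs → (∀ x → x ∈ xs → f x ∼ g x) → concatMap f xs ∼ concatMap g xs
concatMap-cong-∼ f g []       h = ∼-refl
concatMap-cong-∼ f g (x ∷ xs) h = ++-cong (h x (here refl)) (concatMap-cong-∼ f g xs (λ y m → h y (there m)))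

_≈ₜ_ : ℤ × Raw → ℤ × Raw → Set
(c , X) ≈ₜ (d , Y) = c ≡ d × X ≅ Y

Pointwise-≈ₜ⇒∼ : ∀ {L L'} → Pointwise _≈ₜ_ L L' → L ∼ L'
Pointwise-≈ₜ⇒∼ []                   = ∼-refl
Pointwise-≈ₜ⇒∼ ((refl , I) ∷ L≈L') = ∼-trans (∼-iso I) (∼-cons (Pointwise-≈ₜ⇒∼ L≈L'))

map-cong-∼ : ∀ (f g : A → ℤ × Raw) xs → (∀ x → x ∈ xs → f x ≈ₜ g x) → map f xs ∼ map g xs
map-cong-∼ f g xs h = Pointwise-≈ₜ⇒∼ (pointwise xs h)
  where
  pointwise : ∀ xs → (∀ x → x ∈ xs → f x ≈ₜ g x) → Pointwise _≈ₜ_ (map f xs) (map g xs)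
  pointwise []       h = []
  pointwise (x ∷ xs) h = h x (here refl) ∷ pointwise xs (λ y m → h y (there m))

map-const-∼ : ∀ (c : A → ℤ) (Y : Raw) (xs : List A) → map (λ x → (c x , Y)) xs ∼ ((sumℤ (map c xs) , Y) ∷ [])
map-const-∼ c Y []       = ∼-sym ∼-zero
map-const-∼ c Y (x ∷ xs) = ∼-trans (∼-cons (map-const-∼ c Y xs)) (∼-merge ≅-refl)

*H-single-congʳ : ∀ c X {M M'} → M ∼ M' → (((c , X) ∷ []) *H M) ∼ (((c , X) ∷ []) *H M')
*H-single-congʳ c X ∼-refl        = ∼-refl
*H-single-congʳ c X (∼-sym r)     = ∼-sym (*H-single-congʳ c X r)
*H-single-congʳ c X (∼-trans r s) = ∼-trans (*H-single-congʳ c X r) (*H-single-congʳ c X s)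
*H-single-congʳ c X (∼-cons r)    = ∼-cons (*H-single-congʳ c X r)
*H-single-congʳ c X ∼-swap        = ∼-swap
*H-single-congʳ c X {(d , _) ∷ (d' , _) ∷ _} (∼-merge I) =
  ∼-trans (∼-merge (⊔-cong (≅-refl {X}) I)) (∼-coeff (sym (ℤP.*-distribˡ-+ c d d')))
*H-single-congʳ c X ∼-zero        = ∼-trans (∼-coeff (ℤP.*-zeroʳ c)) ∼-zero

*H-congʳ : ∀ (L : HC) {M M'} → M ∼ M' → (L *H M) ∼ (L *H M')
*H-congʳ []            r = ∼-refl
*H-congʳ ((c , X) ∷ L) r =
  ++-cong (∼-trans (≡⇒∼ (sym (LP.++-identityʳ _))) (∼-trans (*H-single-congʳ c X r) (≡⇒∼ (LP.++-identityʳ _))))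
          (*H-congʳ L r)

⊆ᵇ⁻ : ∀ {m} (S T : Subset m) → (S ⊆ᵇ T) ≡ true → ∀ i → Vec.lookup S i ≡ true → Vec.lookup T i ≡ true
⊆ᵇ⁻ (a ∷ S) (b ∷ T) h F.zero    p = ⇒ᵇ≡true⁻ (proj₁ (∧≡true⁻ h)) p
⊆ᵇ⁻ (a ∷ S) (b ∷ T) h (F.suc i) p = ⊆ᵇ⁻ S T (proj₂ (∧≡true⁻ {a ⇒ᵇ b} h)) i p

⊆ᵇ⁺ : ∀ {m} (S T : Subset m) → (∀ i → Vec.lookup S i ≡ true → Vec.lookup T i ≡ true) → (S ⊆ᵇ T) ≡ true
⊆ᵇ⁺ []      []      h = refl
⊆ᵇ⁺ (a ∷ S) (b ∷ T) h = ∧≡true⁺ (⇒ᵇ≡true⁺ (h F.zero)) (⊆ᵇ⁺ S T (h ∘ F.suc))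

⊆ᵇ≡false⁻ : ∀ {m} (S T : Subset m) → (S ⊆ᵇ T) ≡ false → ∃[ i ] (Vec.lookup S i ≡ true × Vec.lookup T i ≡ false)
⊆ᵇ≡false⁻ [] [] ()
⊆ᵇ≡false⁻ (true  ∷ S) (false ∷ T) h = F.zero , refl , refl
⊆ᵇ≡false⁻ (false ∷ S) (b     ∷ T) h = let i , p , q = ⊆ᵇ≡false⁻ S T h in F.suc i , p , q
⊆ᵇ≡false⁻ (true  ∷ S) (true  ∷ T) h = let i , p , q = ⊆ᵇ≡false⁻ S T h in F.suc i , p , q

vec-ext : ∀ {m} (S T : Vec A m) → (∀ i → Vec.lookup S i ≡ Vec.lookup T i) → S ≡ T
vec-ext S T h = trans (sym (VP.tabulate∘lookup S)) (trans (VP.tabulate-cong h) (VP.tabulate∘lookup T))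

==ᵇ⇒≡ : ∀ {m} (S T : Subset m) → (S ==ᵇ T) ≡ true → S ≡ T
==ᵇ⇒≡ S T h = let S⊆T , T⊆S = ∧≡true⁻ h in
  vec-ext S T (λ i → bool-ext (⊆ᵇ⁻ S T S⊆T i) (⊆ᵇ⁻ T S T⊆S i))

⊆ᵇ-refl : ∀ {m} (S : Subset m) → (S ⊆ᵇ S) ≡ true
⊆ᵇ-refl S = ⊆ᵇ⁺ S S (λ i p → p)

==ᵇ-refl : ∀ {m} (S : Subset m) → (S ==ᵇ S) ≡ true
==ᵇ-refl S = ∧≡true⁺ (⊆ᵇ-refl S) (⊆ᵇ-refl S)

⊆ᵇ-trans : ∀ {m} (S T U : Subset m) → (S ⊆ᵇ T) ≡ true → (T ⊆ᵇ U) ≡ true → (S ⊆ᵇ U) ≡ true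
⊆ᵇ-trans S T U p q = ⊆ᵇ⁺ S U (λ i x → ⊆ᵇ⁻ T U q i (⊆ᵇ⁻ S T p i x))

==ᵇ⇒⊆ᵇ : ∀ {m} (S T : Subset m) → (S ==ᵇ T) ≡ true → (S ⊆ᵇ T) ≡ true
==ᵇ⇒⊆ᵇ S T h = proj₁ (∧≡true⁻ h)

⊈ᵇ⇒≠ᵇ : ∀ {m} (S T : Subset m) → (S ⊆ᵇ T) ≡ false → (S ==ᵇ T) ≡ false
⊈ᵇ⇒≠ᵇ S T h with S ==ᵇ T in e
... | false = refl
... | true  = trans (sym (==ᵇ⇒⊆ᵇ S T e)) h

lookup-full : ∀ {m} (i : Fin m) → Vec.lookup (full m) i ≡ true
lookup-full i = VP.lookup-replicate i true

⊆ᵇ-full : ∀ {m} (S : Subset m) → (S ⊆ᵇ full m) ≡ true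
⊆ᵇ-full S = ⊆ᵇ⁺ S _ (λ i _ → lookup-full i)

⊆ᵇ-++ : ∀ {a b} (S₁ T₁ : Subset a) (S₂ T₂ : Subset b) →
  ((S₁ Vec.++ S₂) ⊆ᵇ (T₁ Vec.++ T₂)) ≡ ((S₁ ⊆ᵇ T₁) ∧ (S₂ ⊆ᵇ T₂))
⊆ᵇ-++ []      []      S₂ T₂ = refl
⊆ᵇ-++ (x ∷ S₁) (y ∷ T₁) S₂ T₂ = trans (cong ((x ⇒ᵇ y) ∧_) (⊆ᵇ-++ S₁ T₁ S₂ T₂)) (sym (BP.∧-assoc (x ⇒ᵇ y) _ _))

==ᵇ-++ : ∀ {a b} (S₁ T₁ : Subset a) (S₂ T₂ : Subset b) →
  ((S₁ Vec.++ S₂) ==ᵇ (T₁ Vec.++ T₂)) ≡ ((S₁ ==ᵇ T₁) ∧ (S₂ ==ᵇ T₂))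
==ᵇ-++ S₁ T₁ S₂ T₂ rewrite ⊆ᵇ-++ S₁ T₁ S₂ T₂ | ⊆ᵇ-++ T₁ S₁ T₂ S₂ =
  ∧-interchange (S₁ ⊆ᵇ T₁) (S₂ ⊆ᵇ T₂) (T₁ ⊆ᵇ S₁) (T₂ ⊆ᵇ S₂)

full-++ : ∀ a b → full (a ℕ.+ b) ≡ full a Vec.++ full b
full-++ zero    b = refl
full-++ (suc a) b = cong (true ∷_) (full-++ a b)

take-drop-++ : ∀ {a b} (S₁ : Subset a) (S₂ : Subset b) →
  Vec.take a (S₁ Vec.++ S₂) ≡ S₁ × Vec.drop a (S₁ Vec.++ S₂) ≡ S₂
take-drop-++ {a} S₁ S₂ = VP.++-injective _ S₁ (VP.take++drop≡id a (S₁ Vec.++ S₂))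

count : ∀ {m} → Subset m → ℕ
count {m} S = length (filterᵇ (Vec.lookup S) (allFin m))

count-≤ : ∀ {m} (S : Subset m) → count S ≤ m
count-≤ {m} S = subst (count S ≤_) (LP.length-tabulate {n = m} id) (LP.length-filter (T? ∘ Vec.lookup S) (allFin m))

count-strict : ∀ {m} (S T : Subset m) → (S ⊆ᵇ T) ≡ true → (S ==ᵇ T) ≡ false → count S < count T
count-strict S T S⊆T S≠T with T ⊆ᵇ S in e
... | true rewrite S⊆T = ⊥-elim (true≢false S≠T)
... | false = let i , p , q = ⊆ᵇ≡false⁻ T S e in
  length-filterᵇ-strict _ _ _ (⊆ᵇ⁻ S T S⊆T) i (∈-allFin i) p q

∈-allSubsets : ∀ {m} (S : Subset m) → S ∈ allSubsets m
∈-allSubsets []               = here refl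
∈-allSubsets {suc m} (true ∷ S)  = ∈-++⁺ˡ (∈-map⁺ (true ∷_) (∈-allSubsets S))
∈-allSubsets {suc m} (false ∷ S) = ∈-++⁺ʳ (map (true ∷_) (allSubsets m)) (∈-map⁺ (false ∷_) (∈-allSubsets S))

unique-allSubsets : ∀ m → Unique (allSubsets m)
unique-allSubsets zero    = All.[] ∷ []
unique-allSubsets (suc m) =
  Unique.++⁺ (Unique.map⁺ VP.∷-injectiveʳ (unique-allSubsets m))
             (Unique.map⁺ VP.∷-injectiveʳ (unique-allSubsets m))
             disjoint
  where
  disjoint : ∀ {S} → S ∈ map (true ∷_) (allSubsets m) × S ∈ map (false ∷_) (allSubsets m) → ⊥
  disjoint (p , q) with ∈-map⁻ (true ∷_) p | ∈-map⁻ (false ∷_) q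
  ... | _ , _ , refl | _ , _ , ()

-- ι enumerates the indices where π holds; for π = Vec.lookup S it is the
-- re-indexing of the members used by  restrict R S.
module Selection {m : ℕ} (π : Fin m → Bool) where

  sel : List (Fin m)
  sel = filterᵇ π (allFin m)

  c : ℕ
  c = length sel

  ι : Fin c → Fin m
  ι = lookup sel

  ι-π : ∀ i → π (ι i) ≡ true
  ι-π i = proj₂ (∈-filterᵇ⁻ π (allFin m) (∈-lookup i))

  ι-injective : ∀ i j → ι i ≡ ι j → i ≡ j
  ι-injective = lookup-injective (unique-filterᵇ π (Unique.allFin⁺ m))

  ρ : (k : Fin m) → π k ≡ true → Fin c
  ρ k p = index (∈-filterᵇ⁺ π (∈-allFin k) p)

  ι∘ρ : ∀ k p → ι (ρ k p) ≡ k
  ι∘ρ k p = sym (lookup-index (∈-filterᵇ⁺ π (∈-allFin k) p))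

  ρ∘ι : ∀ i p → ρ (ι i) p ≡ i
  ρ∘ι i p = ι-injective _ _ (ι∘ρ (ι i) p)

  ρ-irrelevant : ∀ k p p' → ρ k p ≡ ρ k p'
  ρ-irrelevant k p p' = ι-injective _ _ (trans (ι∘ρ k p) (sym (ι∘ρ k p')))

halfOpenᵇ : ∀ {m} → Subset m → Subset m → Subset m → Bool
halfOpenᵇ D E F = (D ⊆ᵇ F) ∧ (F ⊆ᵇ E) ∧ not (F ==ᵇ E)

closedᵇ : ∀ {m} → Subset m → Subset m → Subset m → Bool
closedᵇ D E F = (D ⊆ᵇ F) ∧ (F ⊆ᵇ E)

δ : ∀ {m} → Subset m → Subset m → ℤ
δ S T = if S ==ᵇ T then 1ℤ else 0ℤ

μL : ∀ {m} → List (Subset m) → ℕ → Subset m → Subset m → ℤ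
μL L zero    D E = 0ℤ
μL L (suc f) D E =
  if D ==ᵇ E then 1ℤ
  else if D ⊆ᵇ E then ℤ.- sumℤ (map (μL L f D) (filterᵇ (halfOpenᵇ D E) L))
  else 0ℤ

μ-fuel≡μL : ∀ R f D E → μ-fuel R f D E ≡ μL (X R) f D E
μ-fuel≡μL R zero D E = refl
μ-fuel≡μL R (suc f) D E with D ==ᵇ E
... | true = refl
... | false with D ⊆ᵇ E
...   | true  = cong (λ z → ℤ.- sumℤ z) (map-cong-∈ (filterᵇ (halfOpenᵇ D E) (X R)) (λ F _ → μ-fuel≡μL R f D F))
...   | false = refl

halfOpenᵇ-count : ∀ {m} (D E F : Subset m) → halfOpenᵇ D E F ≡ true → count F < count E
halfOpenᵇ-count D E F h = let _ , F⊆E∧F≠E = ∧≡true⁻ {D ⊆ᵇ F} h ; F⊆E , F≠E = ∧≡true⁻ {F ⊆ᵇ E} F⊆E∧F≠E in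
  count-strict F E F⊆E (not≡true⁻ F≠E)

halfOpenᵇ-empty : ∀ {m} (E F : Subset m) → halfOpenᵇ E E F ≡ false
halfOpenᵇ-empty E F with E ⊆ᵇ F in E⊆F | F ⊆ᵇ E in F⊆E
... | false | _     = refl
... | true  | false = refl
... | true  | true with F ==ᵇ E in F≠E
...   | true  = refl
...   | false = ⊥-elim (true≢false (trans (sym (∧≡true⁺ F⊆E E⊆F)) F≠E))

module _ {m : ℕ} (L : List (Subset m)) where

  μL-refl : ∀ f (D E : Subset m) → (D ==ᵇ E) ≡ true → μL L (suc f) D E ≡ 1ℤ
  μL-refl f D E h rewrite h = refl

  μL-step : ∀ f (D E : Subset m) → (D ==ᵇ E) ≡ false → (D ⊆ᵇ E) ≡ true →
    μL L (suc f) D E ≡ ℤ.- sumℤ (map (μL L f D) (filterᵇ (halfOpenᵇ D E) L))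
  μL-step f D E h h' rewrite h | h' = refl

  μL-⊈ : ∀ f (D E : Subset m) → (D ⊆ᵇ E) ≡ false → μL L (suc f) D E ≡ 0ℤ
  μL-⊈ f D E h rewrite ⊈ᵇ⇒≠ᵇ D E h | h = refl

  μL-fuel-irrelevant : ∀ f f' (D E : Subset m) → count E < f → count E < f' → μL L f D E ≡ μL L f' D E
  μL-fuel-irrelevant (suc f) (suc f') D E (s≤s p) (s≤s q) with D ==ᵇ E
  ... | true = refl
  ... | false with D ⊆ᵇ E
  ...   | true  = cong (λ z → ℤ.- sumℤ z) (map-cong-∈ (filterᵇ (halfOpenᵇ D E) L) (λ F F∈ →
            let lt = halfOpenᵇ-count D E F (proj₂ (∈-filterᵇ⁻ (halfOpenᵇ D E) L F∈)) in
            μL-fuel-irrelevant f f' D F (ℕP.<-≤-trans lt p) (ℕP.<-≤-trans lt q)))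
  ...   | false = refl

  μ⋆ : Subset m → Subset m → ℤ
  μ⋆ = μL L (suc m)

  μ⋆≡μL : ∀ f (D E : Subset m) → count E < f → μ⋆ D E ≡ μL L f D E
  μ⋆≡μL f D E lt = μL-fuel-irrelevant (suc m) f D E (s≤s (count-≤ E)) lt

filterᵇ-==ᵇ : ∀ {m} (L : List (Subset m)) E → Unique L → E ∈ L → filterᵇ (_==ᵇ E) L ≡ E ∷ []
filterᵇ-==ᵇ (x ∷ L) E (x∉L ∷ u) E∈ with x ==ᵇ E in e
... | true with ==ᵇ⇒≡ x E e
...   | refl = cong (E ∷_) (filterᵇ-none _ L others)
  where
  others : ∀ F → F ∈ L → (F ==ᵇ E) ≡ false
  others F F∈ with F ==ᵇ E in e'
  ... | true  = ⊥-elim (All.lookup x∉L F∈ (sym (==ᵇ⇒≡ F E e')))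
  ... | false = refl
filterᵇ-==ᵇ (x ∷ L) E (_ ∷ u) (here refl) | false = ⊥-elim (true≢false (trans (sym (==ᵇ-refl x)) e))
filterᵇ-==ᵇ (x ∷ L) E (_ ∷ u) (there E∈) | false = filterᵇ-==ᵇ L E u E∈

closedᵇ-split : ∀ {m} (L : List (Subset m)) D E → Unique L → E ∈ L → (D ⊆ᵇ E) ≡ true →
  filterᵇ (closedᵇ D E) L ↭ E ∷ filterᵇ (halfOpenᵇ D E) L
closedᵇ-split L D E u E∈ D⊆E =
  Perm.trans (filterᵇ-partition (closedᵇ D E) (_==ᵇ E) L)
    (PermP.++⁺ (Perm.↭-reflexive (trans (filterᵇ-cong-∈ L (λ F _ → top F)) (filterᵇ-==ᵇ L E u E∈)))
               (Perm.↭-reflexive (filterᵇ-cong-∈ L (λ F _ → BP.∧-assoc (D ⊆ᵇ F) (F ⊆ᵇ E) _))))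
  where
  top : ∀ F → (closedᵇ D E F ∧ (F ==ᵇ E)) ≡ (F ==ᵇ E)
  top F with F ==ᵇ E in e
  ... | false = BP.∧-zeroʳ _
  ... | true with ==ᵇ⇒≡ F E e
  ...   | refl rewrite D⊆E | ⊆ᵇ-refl F = refl

-- The recursion defining μ, read as  Σ_{D ⊆ F ⊆ E} μ(D, F) = δ(D, E).
μ⋆-interval-sum : ∀ {m} (L : List (Subset m)) D E → Unique L → E ∈ L → (D ⊆ᵇ E) ≡ true →
  sumℤ (map (μ⋆ L D) (filterᵇ (closedᵇ D E) L)) ≡ δ D E
μ⋆-interval-sum {m} L D E u E∈ D⊆E =
  trans (sumℤ-↭ (PermP.map⁺ (μ⋆ L D) (closedᵇ-split L D E u E∈ D⊆E))) top+rest
  where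
  top+rest : μ⋆ L D E ℤ.+ sumℤ (map (μ⋆ L D) (filterᵇ (halfOpenᵇ D E) L)) ≡ δ D E
  top+rest with D ==ᵇ E in e
  ... | true rewrite ==ᵇ⇒≡ D E e | filterᵇ-none (halfOpenᵇ E E) L (λ F _ → halfOpenᵇ-empty E F) = refl
  ... | false rewrite D⊆E =
    trans (cong (λ z → ℤ.- sumℤ (map (μL L m D) (filterᵇ (halfOpenᵇ D E) L)) ℤ.+ sumℤ z)
            (map-cong-∈ (filterᵇ (halfOpenᵇ D E) L) (λ F F∈ →
              μ⋆≡μL L m D F (ℕP.<-≤-trans (halfOpenᵇ-count D E F (proj₂ (∈-filterᵇ⁻ (halfOpenᵇ D E) L F∈)))
                                          (count-≤ E)))))
          (ℤP.+-inverseˡ (sumℤ (map (μL L m D) (filterᵇ (halfOpenᵇ D E) L))))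

μL-transfer : ∀ {a b} (L : List (Subset a)) (L' : List (Subset b)) (e : Subset a → Subset b) →
  (∀ S T → S ∈ L → T ∈ L → (e S ⊆ᵇ e T) ≡ (S ⊆ᵇ T)) →
  (∀ D E → D ∈ L → E ∈ L → filterᵇ (halfOpenᵇ (e D) (e E)) L' ↭ map e (filterᵇ (halfOpenᵇ D E) L)) →
  ∀ f D E → D ∈ L → E ∈ L → μL L' f (e D) (e E) ≡ μL L f D E
μL-transfer L L' e e-⊆ e-int zero D E D∈ E∈ = refl
μL-transfer L L' e e-⊆ e-int (suc f) D E D∈ E∈
  rewrite e-⊆ D E D∈ E∈ | e-⊆ E D E∈ D∈ with D ==ᵇ E
... | true = refl
... | false with D ⊆ᵇ E
...   | false = refl
...   | true  = cong ℤ.-_ (trans (sumℤ-↭ (PermP.map⁺ (μL L' f (e D)) (e-int D E D∈ E∈)))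
                  (cong sumℤ (trans (sym (LP.map-∘ (filterᵇ (halfOpenᵇ D E) L)))
                    (map-cong-∈ (filterᵇ (halfOpenᵇ D E) L) (λ F F∈ →
                      μL-transfer L L' e e-⊆ e-int f D F D∈ (proj₁ (∈-filterᵇ⁻ (halfOpenᵇ D E) L F∈)))))))

DownClosed : (R : Raw) → Subset (m R) → Set
DownClosed R S = ∀ i j → Vec.lookup S j ≡ true → ord R i j ≡ true → Vec.lookup S i ≡ true

HasSingletons : (R : Raw) → Subset (m R) → Set
HasSingletons R S = ∀ i → isSingletonᵇ (fam R i) ≡ true → Vec.lookup S i ≡ true

isSubᵇ⁻ : ∀ R S → isSubᵇ R S ≡ true → DownClosed R S × HasSingletons R S
isSubᵇ⁻ R S h = let dc , sg = ∧≡true⁻ h in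
  (λ i j p q → ⇒ᵇ≡true⁻ (allFinᵇ≡true⁻ _ (allFinᵇ≡true⁻ _ dc i) j) (∧≡true⁺ p q)) ,
  (λ i p → ⇒ᵇ≡true⁻ (allFinᵇ≡true⁻ _ sg i) p)

isSubᵇ⁺ : ∀ R S → DownClosed R S → HasSingletons R S → isSubᵇ R S ≡ true
isSubᵇ⁺ R S dc sg = ∧≡true⁺
  (allFinᵇ≡true⁺ _ (λ i → allFinᵇ≡true⁺ _ (λ j → ⇒ᵇ≡true⁺ (λ pq → let p , q = ∧≡true⁻ pq in dc i j p q))))
  (allFinᵇ≡true⁺ _ (λ i → ⇒ᵇ≡true⁺ (sg i)))

∈X⁻ : ∀ R {S} → S ∈ X R → isSubᵇ R S ≡ true
∈X⁻ R S∈ = proj₂ (∈-filterᵇ⁻ (isSubᵇ R) (allSubsets _) S∈)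

∈X⁺ : ∀ R {S} → isSubᵇ R S ≡ true → S ∈ X R
∈X⁺ R h = ∈-filterᵇ⁺ (isSubᵇ R) (∈-allSubsets _) h

unique-X : ∀ R → Unique (X R)
unique-X R = unique-filterᵇ (isSubᵇ R) (unique-allSubsets (m R))

full∈X : ∀ R → full (m R) ∈ X R
full∈X R = ∈X⁺ R (isSubᵇ⁺ R (full (m R)) (λ i j _ _ → lookup-full i) (λ i _ → lookup-full i))

restrict-full : ∀ R → restrict R (full (m R)) ≅ R
restrict-full R = record
  { σ = ↔-refl
  ; τ = ↔-from-same-image ι id ι-injective (λ a b h → h) ι (λ _ → refl) (λ k → ρ k (lookup-full k)) (λ k → ι∘ρ k _)
  ; fam-resp = λ i k → refl ; ord-resp = λ i j → refl }
  where open Selection (Vec.lookup (full (m R)))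

isYes-true : ∀ {P : Set} (d : Dec P) → P → isYes d ≡ true
isYes-true d p = trans (isYes≗does d) (dec-true d p)

isYes-false : ∀ {P : Set} (d : Dec P) → ¬ P → isYes d ≡ false
isYes-false d ¬p = trans (isYes≗does d) (dec-false d ¬p)

isYes-≟-injective : ∀ {N M} (f : Fin N → Fin M) → (∀ x y → f x ≡ f y → x ≡ y) →
  ∀ a b → isYes (f a ≟ f b) ≡ isYes (a ≟ b)
isYes-≟-injective f inj a b with a ≟ b
... | yes e = isYes-true (f a ≟ f b) (cong f e)
... | no ne = isYes-false (f a ≟ f b) (λ e → ne (inj a b e))

IsSingleton⇒isSingletonᵇ : ∀ {N} (k : Fin N) (g : Fin N → ℕ) → IsSingleton k g → isSingletonᵇ g ≡ true
IsSingleton⇒isSingletonᵇ {N} k g sg = cong (ℕ._≡ᵇ 1) (sum-one (allFin N) (Unique.allFin⁺ N) (∈-allFin k))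
  where
  sum-zero : ∀ xs → (∀ x → x ∈ xs → k ≢ x) → sum (map g xs) ≡ 0
  sum-zero []       h = refl
  sum-zero (x ∷ xs) h rewrite sg x | isYes-false (k ≟ x) (h x (here refl)) = sum-zero xs (λ y m → h y (there m))
  sum-one : ∀ xs → Unique xs → k ∈ xs → sum (map g xs) ≡ 1
  sum-one (x ∷ xs) (x∉ ∷ u) (here refl) rewrite sg k | isYes-true (k ≟ k) refl =
    cong suc (sum-zero xs (λ y y∈ → All.lookup x∉ y∈))
  sum-one (x ∷ xs) (x∉ ∷ u) (there k∈) rewrite sg x | isYes-false (k ≟ x) (λ { refl → All.lookup x∉ k∈ refl }) =
    sum-one xs u k∈

restrict-isMultiComplex : ∀ R → IsMultiComplex R → ∀ S → isSubᵇ R S ≡ true → IsMultiComplex (restrict R S)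
restrict-isMultiComplex R mc S S-sub = record
  { nonempty = λ i → nonempty (ι i)
  ; ord-refl = λ i → ord-refl (ι i)
  ; ord-antisym = λ i j p q → ι-injective i j (ord-antisym (ι i) (ι j) p q)
  ; ord-trans = λ i j l p q → ord-trans (ι i) (ι j) (ι l) p q
  ; singleton-unique = singleton-unique′
  ; singleton-ord = λ k i j sg → singleton-ord k (ι i) (ι j) sg
  ; ord-contained = λ i j p k → ord-contained (ι i) (ι j) p k }
  where
  open IsMultiComplex mc
  open Selection (Vec.lookup S)
  singleton-unique′ : ∀ k → Σ (Fin c) λ i → IsSingleton k (fam R (ι i)) × (∀ j → IsSingleton k (fam R (ι j)) → j ≡ i)
  singleton-unique′ k with singleton-unique k
  ... | i , sg , uq = let p = proj₂ (isSubᵇ⁻ R S S-sub) i (IsSingleton⇒isSingletonᵇ k (fam R i) sg) in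
    ρ i p , subst (λ z → IsSingleton k (fam R z)) (sym (ι∘ρ i p)) sg ,
    λ j sj → ι-injective j (ρ i p) (trans (uq (ι j) sj) (sym (ι∘ρ i p)))

-- The sub-multi-complexes of  restrict R S  are those of R contained in S.
module Restriction (R : Raw) (S : Subset (m R)) where
  open Selection (Vec.lookup S)

  R' : Raw
  R' = restrict R S

  extend : Subset c → Subset (m R)
  extend T = Vec.tabulate (λ k → ifᵈ (Vec.lookup S k) (λ p → Vec.lookup T (ρ k p)))

  shrink : Subset (m R) → Subset c
  shrink T = Vec.tabulate (λ i → Vec.lookup T (ι i))

  lookup-extend-in : ∀ T k (p : Vec.lookup S k ≡ true) → Vec.lookup (extend T) k ≡ Vec.lookup T (ρ k p)
  lookup-extend-in T k p = trans (VP.lookup∘tabulate _ k) (ifᵈ-true _ _ p)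

  lookup-extend-out : ∀ T k → Vec.lookup S k ≡ false → Vec.lookup (extend T) k ≡ false
  lookup-extend-out T k p = trans (VP.lookup∘tabulate _ k) (ifᵈ-false _ _ p)

  lookup-extend-ι : ∀ T i → Vec.lookup (extend T) (ι i) ≡ Vec.lookup T i
  lookup-extend-ι T i = trans (lookup-extend-in T (ι i) (ι-π i)) (cong (Vec.lookup T) (ρ∘ι i (ι-π i)))

  extend-⊆S : ∀ T k → Vec.lookup (extend T) k ≡ true → Vec.lookup S k ≡ true
  extend-⊆S T k h with Vec.lookup S k in eq
  ... | true  = refl
  ... | false = trans (sym (lookup-extend-out T k eq)) h

  extend-⊆ᵇ : ∀ T U → (extend T ⊆ᵇ extend U) ≡ (T ⊆ᵇ U)
  extend-⊆ᵇ T U = bool-ext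
    (λ h → ⊆ᵇ⁺ T U (λ i p → trans (sym (lookup-extend-ι U i))
                              (⊆ᵇ⁻ (extend T) (extend U) h (ι i) (trans (lookup-extend-ι T i) p))))
    (λ h → ⊆ᵇ⁺ (extend T) (extend U) (λ k p → let s = extend-⊆S T k p in
       trans (lookup-extend-in U k s) (⊆ᵇ⁻ T U h (ρ k s) (trans (sym (lookup-extend-in T k s)) p))))

  extend-injective : ∀ T U → extend T ≡ extend U → T ≡ U
  extend-injective T U h = vec-ext T U (λ i →
    trans (sym (lookup-extend-ι T i)) (trans (cong (λ z → Vec.lookup z (ι i)) h) (lookup-extend-ι U i)))

  extend-full : extend (full c) ≡ S
  extend-full = vec-ext _ S pointwise
    where
    pointwise : ∀ k → Vec.lookup (extend (full c)) k ≡ Vec.lookup S k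
    pointwise k with Vec.lookup S k in eq
    ... | true  = trans (lookup-extend-in (full c) k eq) (lookup-full {c} (ρ k eq))
    ... | false = lookup-extend-out (full c) k eq

  extend-shrink : ∀ T → (T ⊆ᵇ S) ≡ true → extend (shrink T) ≡ T
  extend-shrink T T⊆S = vec-ext _ T pointwise
    where
    pointwise : ∀ k → Vec.lookup (extend (shrink T)) k ≡ Vec.lookup T k
    pointwise k with Vec.lookup S k in eq
    ... | true = trans (lookup-extend-in (shrink T) k eq)
                   (trans (VP.lookup∘tabulate _ (ρ k eq)) (cong (Vec.lookup T) (ι∘ρ k eq)))
    ... | false with Vec.lookup T k in eq₂
    ...   | false = lookup-extend-out (shrink T) k eq
    ...   | true  = ⊥-elim (true≢false (trans (sym (⊆ᵇ⁻ T S T⊆S k eq₂)) eq))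

  module _ (S-sub : isSubᵇ R S ≡ true) where
    private
      S-dc = proj₁ (isSubᵇ⁻ R S S-sub)
      S-sg = proj₂ (isSubᵇ⁻ R S S-sub)

    isSubᵇ-extend : ∀ T → isSubᵇ R' T ≡ isSubᵇ R (extend T)
    isSubᵇ-extend T = bool-ext to from
      where
      to : isSubᵇ R' T ≡ true → isSubᵇ R (extend T) ≡ true
      to h = let dc , sg = isSubᵇ⁻ R' T h in isSubᵇ⁺ R (extend T)
        (λ i j pj o → let sj = extend-⊆S T j pj ; si = S-dc i j sj o in
           trans (lookup-extend-in T i si) (dc (ρ i si) (ρ j sj) (trans (sym (lookup-extend-in T j sj)) pj)
             (subst₂ (λ a b → ord R a b ≡ true) (sym (ι∘ρ i si)) (sym (ι∘ρ j sj)) o)))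
        (λ i s → let si = S-sg i s in trans (lookup-extend-in T i si)
           (sg (ρ i si) (subst (λ a → isSingletonᵇ (fam R a) ≡ true) (sym (ι∘ρ i si)) s)))
      from : isSubᵇ R (extend T) ≡ true → isSubᵇ R' T ≡ true
      from h = let dc , sg = isSubᵇ⁻ R (extend T) h in isSubᵇ⁺ R' T
        (λ i j pj o → trans (sym (lookup-extend-ι T i)) (dc (ι i) (ι j) (trans (lookup-extend-ι T j) pj) o))
        (λ i s → trans (sym (lookup-extend-ι T i)) (sg (ι i) s))

    X-restrict : map extend (X R') ↭ filterᵇ (_⊆ᵇ S) (X R)
    X-restrict = unique∧same-elements⇒↭
      (Unique.map⁺ (extend-injective _ _) (unique-X R')) (unique-filterᵇ _ (unique-X R)) to from
      where
      to : ∀ {z} → z ∈ map extend (X R') → z ∈ filterᵇ (_⊆ᵇ S) (X R)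
      to z∈ with ∈-map⁻ extend z∈
      ... | T , T∈ , refl = ∈-filterᵇ⁺ _ (∈X⁺ R (trans (sym (isSubᵇ-extend T)) (∈X⁻ R' T∈))) (⊆ᵇ⁺ (extend T) S (extend-⊆S T))
      from : ∀ {z} → z ∈ filterᵇ (_⊆ᵇ S) (X R) → z ∈ map extend (X R')
      from {z} z∈ = let z∈X , z⊆S = ∈-filterᵇ⁻ _ (X R) z∈ in
        subst (_∈ map extend (X R')) (extend-shrink z z⊆S)
          (∈-map⁺ extend (∈X⁺ R' {shrink z}
            (trans (isSubᵇ-extend (shrink z)) (trans (cong (isSubᵇ R) (extend-shrink z z⊆S)) (∈X⁻ R z∈X)))))

    halfOpenᵇ-extend : ∀ D E F → halfOpenᵇ (extend D) (extend E) (extend F) ≡ halfOpenᵇ D E F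
    halfOpenᵇ-extend D E F rewrite extend-⊆ᵇ D F | extend-⊆ᵇ F E | extend-⊆ᵇ E F = refl

    X-restrict-halfOpen : ∀ D E → D ∈ X R' → E ∈ X R' →
      filterᵇ (halfOpenᵇ (extend D) (extend E)) (X R) ↭ map extend (filterᵇ (halfOpenᵇ D E) (X R'))
    X-restrict-halfOpen D E _ _ =
      Perm.trans (Perm.↭-reflexive (trans (filterᵇ-cong-∈ (X R) (λ F _ → sym (below-S F)))
                                          (sym (filterᵇ-filterᵇ _ _ (X R)))))
        (Perm.trans (filterᵇ-↭ _ (Perm.↭-sym X-restrict))
          (Perm.↭-reflexive (trans (filterᵇ-map _ extend (X R'))
            (cong (map extend) (filterᵇ-cong-∈ (X R') (λ F _ → halfOpenᵇ-extend D E F))))))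
      where
      below-S : ∀ F → ((F ⊆ᵇ S) ∧ halfOpenᵇ (extend D) (extend E) F) ≡ halfOpenᵇ (extend D) (extend E) F
      below-S F with halfOpenᵇ (extend D) (extend E) F in h
      ... | false = BP.∧-zeroʳ _
      ... | true  = let _ , rest = ∧≡true⁻ {extend D ⊆ᵇ F} h ; F⊆E , _ = ∧≡true⁻ {F ⊆ᵇ extend E} rest in
                    cong (_∧ true) (⊆ᵇ-trans F (extend E) S F⊆E (⊆ᵇ⁺ (extend E) S (extend-⊆S E)))

    μP-restrict : ∀ T → T ∈ X R' → μP R' T (full c) ≡ μ⋆ (X R) (extend T) S
    μP-restrict T T∈ = begin
      μP R' T (full c)                           ≡⟨ μ-fuel≡μL R' (suc c) T (full c) ⟩
      μL (X R') (suc c) T (full c)               ≡⟨ μL-transfer (X R') (X R) extend (λ a b _ _ → extend-⊆ᵇ a b)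
                                                      X-restrict-halfOpen (suc c) T (full c) T∈ (full∈X R') ⟨
      μL (X R) (suc c) (extend T) (extend (full c)) ≡⟨ cong (μL (X R) (suc c) (extend T)) extend-full ⟩
      μL (X R) (suc c) (extend T) S               ≡⟨ μ⋆≡μL (X R) (suc c) (extend T) S ℕP.≤-refl ⟨
      μ⋆ (X R) (extend T) S                       ∎
      where open ≡-Reasoning

    restrict-restrict : ∀ T → restrict R' T ≅ restrict R (extend T)
    restrict-restrict T = record
      { σ = ↔-refl
      ; τ = ↔-from-same-image ι₁ Sᵉ.ι ι₁-injective Sᵉ.ι-injective f f-ok g g-ok
      ; fam-resp = λ i k → cong (λ a → fam R a k) (f-ok i)
      ; ord-resp = λ i j → cong₂ (ord R) (f-ok i) (f-ok j) }
      where
      module Sᵀ = Selection (Vec.lookup T)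
      module Sᵉ = Selection (Vec.lookup (extend T))
      ι₁ : Fin Sᵀ.c → Fin (m R)
      ι₁ i = ι (Sᵀ.ι i)
      ι₁-injective : ∀ a b → ι₁ a ≡ ι₁ b → a ≡ b
      ι₁-injective a b h = Sᵀ.ι-injective a b (ι-injective _ _ h)
      f : Fin Sᵀ.c → Fin Sᵉ.c
      f i = Sᵉ.ρ (ι₁ i) (trans (lookup-extend-ι T (Sᵀ.ι i)) (Sᵀ.ι-π i))
      f-ok : ∀ i → Sᵉ.ι (f i) ≡ ι₁ i
      f-ok i = Sᵉ.ι∘ρ _ _
      g : Fin Sᵉ.c → Fin Sᵀ.c
      g j = let s = extend-⊆S T (Sᵉ.ι j) (Sᵉ.ι-π j) in
            Sᵀ.ρ (ρ (Sᵉ.ι j) s) (trans (sym (lookup-extend-in T (Sᵉ.ι j) s)) (Sᵉ.ι-π j))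
      g-ok : ∀ j → ι₁ (g j) ≡ Sᵉ.ι j
      g-ok j = trans (cong ι (Sᵀ.ι∘ρ _ _)) (ι∘ρ _ _)

    P-restrict : P R' ∼ map (λ T → (μ⋆ (X R) T S , restrict R T)) (filterᵇ (_⊆ᵇ S) (X R))
    P-restrict =
      ∼-trans (map-cong-∼ _ (λ T → (μ⋆ (X R) (extend T) S , restrict R (extend T))) (X R')
                          (λ T T∈ → μP-restrict T T∈ , restrict-restrict T))
        (∼-trans (≡⇒∼ (LP.map-∘ (X R')))
          (↭⇒∼ (PermP.map⁺ (λ T → (μ⋆ (X R) T S , restrict R T)) X-restrict)))

-- Möbius inversion:  [C] = Σ_{D ⪯ C} P_D

concatMap-δ : ∀ {m} (Y : Subset m → Raw) (L : List (Subset m)) E → Unique L → E ∈ L →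
  concatMap (λ T → (δ T E , Y T) ∷ []) L ∼ ((1ℤ , Y E) ∷ [])
concatMap-δ Y (x ∷ L) E (x∉L ∷ u) E∈ with x ==ᵇ E in eq
... | true with ==ᵇ⇒≡ x E eq
...   | refl = ∼-cons (vanish L (λ F F∈ → ≠x F F∈))
  where
  ≠x : ∀ F → F ∈ L → (F ==ᵇ x) ≡ false
  ≠x F F∈ with F ==ᵇ x in e'
  ... | true  = ⊥-elim (All.lookup x∉L F∈ (sym (==ᵇ⇒≡ F x e')))
  ... | false = refl
  vanish : ∀ L' → (∀ F → F ∈ L' → (F ==ᵇ x) ≡ false) → concatMap (λ T → (δ T x , Y T) ∷ []) L' ∼ []
  vanish []       _ = ∼-refl
  vanish (F ∷ L') h rewrite h F (here refl) = ∼-trans ∼-zero (vanish L' (λ G G∈ → h G (there G∈)))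
concatMap-δ Y (x ∷ L) E (_ ∷ u) (here refl) | false = ⊥-elim (true≢false (trans (sym (==ᵇ-refl x)) eq))
concatMap-δ Y (x ∷ L) E (_ ∷ u) (there E∈)  | false = ∼-trans ∼-zero (concatMap-δ Y L E u E∈)

basis-mobius-inversion : ∀ R → basis R ∼ concatMap (λ S → P (restrict R S)) (X R)
basis-mobius-inversion R = ∼-sym (begin
  concatMap (λ S → P (restrict R S)) XR
    ≈⟨ concatMap-cong-∼ _ _ XR (λ S S∈ → Restriction.P-restrict R S (∈X⁻ R S∈)) ⟩
  concatMap (λ S → map (λ T → term T S) (filterᵇ (_⊆ᵇ S) XR)) XR
    ≈⟨ ↭⇒∼ (concatMap-filterᵇ-comm term _⊆ᵇ_ XR) ⟩
  concatMap (λ T → map (term T) (filterᵇ (T ⊆ᵇ_) XR)) XR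
    ≈⟨ concatMap-cong-∼ _ _ XR (λ T _ → ∼-trans (map-const-∼ (μ⋆ XR T) (restrict R T) (filterᵇ (T ⊆ᵇ_) XR))
                                                  (∼-coeff (upper-sum T))) ⟩
  concatMap (λ T → (δ T top , restrict R T) ∷ []) XR
    ≈⟨ concatMap-δ (restrict R) XR top (unique-X R) (full∈X R) ⟩
  (1ℤ , restrict R top) ∷ []
    ≈⟨ ∼-iso (restrict-full R) ⟩
  basis R ∎)
  where
  open ∼-Reasoning
  XR = X R
  top = full (m R)
  term : Subset (m R) → Subset (m R) → ℤ × Raw
  term T S = μ⋆ XR T S , restrict R T
  upper-sum : ∀ T → sumℤ (map (μ⋆ XR T) (filterᵇ (T ⊆ᵇ_) XR)) ≡ δ T top
  upper-sum T = trans (cong (λ z → sumℤ (map (μ⋆ XR T) z))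
                        (filterᵇ-cong-∈ XR (λ S _ → sym (trans (cong ((T ⊆ᵇ S) ∧_) (⊆ᵇ-full S)) (BP.∧-identityʳ _)))))
                      (μ⋆-interval-sum XR T top (unique-X R) (full∈X R) (⊆ᵇ-full T))

-- Multiplicativity:  P_{A ⊔ B} = P_A P_B

ΣFin : ∀ {n} → (Fin n → ℕ) → ℕ
ΣFin {n} g = sum (map g (allFin n))

allFin-+ : ∀ a b → allFin (a ℕ.+ b) ↭ map (_↑ˡ b) (allFin a) ++ map (a ↑ʳ_) (allFin b)
allFin-+ a b = unique∧same-elements⇒↭ (Unique.allFin⁺ _)
  (Unique.++⁺ (Unique.map⁺ (FP.↑ˡ-injective b _ _) (Unique.allFin⁺ a))
              (Unique.map⁺ (FP.↑ʳ-injective a _ _) (Unique.allFin⁺ b)) disjoint)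
  (λ {z} _ → on-both-sides z (splitView a b z)) (λ {z} _ → ∈-allFin z)
  where
  disjoint : ∀ {x} → x ∈ map (_↑ˡ b) (allFin a) × x ∈ map (a ↑ʳ_) (allFin b) → ⊥
  disjoint (p , q) with ∈-map⁻ (_↑ˡ b) p | ∈-map⁻ (a ↑ʳ_) q
  ... | i , _ , e₁ | j , _ , e₂ = ↑ˡ≢↑ʳ i j (trans (sym e₁) e₂)
  on-both-sides : ∀ z → SplitView a b z → z ∈ map (_↑ˡ b) (allFin a) ++ map (a ↑ʳ_) (allFin b)
  on-both-sides .(i ↑ˡ b) (left i)  = ∈-++⁺ˡ (∈-map⁺ _ (∈-allFin i))
  on-both-sides .(a ↑ʳ j) (right j) = ∈-++⁺ʳ (map (_↑ˡ b) (allFin a)) (∈-map⁺ _ (∈-allFin j))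

ΣFin-+ : ∀ a b (g : Fin (a ℕ.+ b) → ℕ) → ΣFin g ≡ ΣFin (g ∘ (_↑ˡ b)) ℕ.+ ΣFin (g ∘ (a ↑ʳ_))
ΣFin-+ a b g = begin
  sum (map g (allFin (a ℕ.+ b)))
    ≡⟨ ℕLP.sum-↭ (PermP.map⁺ g (allFin-+ a b)) ⟩
  sum (map g (map (_↑ˡ b) (allFin a) ++ map (a ↑ʳ_) (allFin b)))
    ≡⟨ cong sum (LP.map-++ g (map (_↑ˡ b) (allFin a)) (map (a ↑ʳ_) (allFin b))) ⟩
  sum (map g (map (_↑ˡ b) (allFin a)) ++ map g (map (a ↑ʳ_) (allFin b)))
    ≡⟨ ℕLP.sum-++ (map g (map (_↑ˡ b) (allFin a))) _ ⟩
  sum (map g (map (_↑ˡ b) (allFin a))) ℕ.+ sum (map g (map (a ↑ʳ_) (allFin b)))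
    ≡⟨ cong₂ ℕ._+_ (cong sum (sym (LP.map-∘ (allFin a)))) (cong sum (sym (LP.map-∘ (allFin b)))) ⟩
  ΣFin (g ∘ (_↑ˡ b)) ℕ.+ ΣFin (g ∘ (a ↑ʳ_)) ∎
  where open ≡-Reasoning

ΣFin-zero : ∀ n (g : Fin n → ℕ) → (∀ k → g k ≡ 0) → ΣFin g ≡ 0
ΣFin-zero n g h = sum-zero (allFin n)
  where
  sum-zero : ∀ xs → sum (map g xs) ≡ 0
  sum-zero []       = refl
  sum-zero (x ∷ xs) rewrite h x = sum-zero xs

filterᵇ-cartesianProduct : ∀ {a b} (p : Subset a → Bool) (q : Subset b → Bool) (w : Subset (a ℕ.+ b) → Bool) →
  (∀ S₁ S₂ → w (S₁ Vec.++ S₂) ≡ (p S₁ ∧ q S₂)) → ∀ L₁ L₂ →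
  filterᵇ w (cartesianProductWith Vec._++_ L₁ L₂) ≡ cartesianProductWith Vec._++_ (filterᵇ p L₁) (filterᵇ q L₂)
filterᵇ-cartesianProduct p q w hw []       L₂ = refl
filterᵇ-cartesianProduct p q w hw (x ∷ L₁) L₂ with p x in e
... | true  = trans (LP.filter-++ (T? ∘ w) (map (x Vec.++_) L₂) _)
                (cong₂ _++_ (trans (filterᵇ-map w (x Vec.++_) L₂)
                                   (cong (map (x Vec.++_)) (filterᵇ-cong-∈ L₂ (λ y _ → trans (hw x y) (cong (_∧ q y) e)))))
                            (filterᵇ-cartesianProduct p q w hw L₁ L₂))
... | false = trans (LP.filter-++ (T? ∘ w) (map (x Vec.++_) L₂) _)
                (cong₂ _++_ (trans (filterᵇ-map w (x Vec.++_) L₂)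
                                   (cong (map (x Vec.++_)) (filterᵇ-none _ L₂ (λ y _ → trans (hw x y) (cong (_∧ q y) e)))))
                            (filterᵇ-cartesianProduct p q w hw L₁ L₂))

sumℤ-cartesianProduct : ∀ {a b} (u : Subset a → ℤ) (v : Subset b → ℤ) (w : Subset (a ℕ.+ b) → ℤ) →
  (∀ S₁ S₂ → w (S₁ Vec.++ S₂) ≡ u S₁ ℤ.* v S₂) → ∀ L₁ L₂ →
  sumℤ (map w (cartesianProductWith Vec._++_ L₁ L₂)) ≡ sumℤ (map u L₁) ℤ.* sumℤ (map v L₂)
sumℤ-cartesianProduct u v w hw []       L₂ = sym (ℤP.*-zeroˡ (sumℤ (map v L₂)))
sumℤ-cartesianProduct u v w hw (x ∷ L₁) L₂ = begin
  sumℤ (map w (map (x Vec.++_) L₂ ++ rest))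
    ≡⟨ cong sumℤ (LP.map-++ w (map (x Vec.++_) L₂) rest) ⟩
  sumℤ (map w (map (x Vec.++_) L₂) ++ map w rest)
    ≡⟨ sumℤ-++ (map w (map (x Vec.++_) L₂)) (map w rest) ⟩
  sumℤ (map w (map (x Vec.++_) L₂)) ℤ.+ sumℤ (map w rest)
    ≡⟨ cong₂ ℤ._+_ row (sumℤ-cartesianProduct u v w hw L₁ L₂) ⟩
  u x ℤ.* sumℤ (map v L₂) ℤ.+ sumℤ (map u L₁) ℤ.* sumℤ (map v L₂)
    ≡⟨ ℤP.*-distribʳ-+ (sumℤ (map v L₂)) (u x) _ ⟨
  sumℤ (map u (x ∷ L₁)) ℤ.* sumℤ (map v L₂) ∎
  where
  open ≡-Reasoning
  rest = cartesianProductWith Vec._++_ L₁ L₂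
  row : sumℤ (map w (map (x Vec.++_) L₂)) ≡ u x ℤ.* sumℤ (map v L₂)
  row = trans (cong sumℤ (trans (sym (LP.map-∘ L₂)) (trans (map-cong-∈ L₂ (λ y _ → hw x y)) (LP.map-∘ L₂))))
              (sumℤ-map-* (u x) (map v L₂))

module Union (A B : Raw) where
  a = m A
  b = m B
  AB = A ⊔ B

  isSingletonᵇ-⊔ˡ : ∀ i → isSingletonᵇ (fam AB (i ↑ˡ b)) ≡ isSingletonᵇ (fam A i)
  isSingletonᵇ-⊔ˡ i = cong (ℕ._≡ᵇ 1) (trans (ΣFin-+ (n A) (n B) (fam AB (i ↑ˡ b)))
    (trans (cong₂ ℕ._+_ (cong sum (LP.map-cong (fam-⊔ˡˡ A B i) (allFin (n A))))
                        (ΣFin-zero (n B) _ (fam-⊔ˡʳ A B i)))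
           (ℕP.+-identityʳ _)))

  isSingletonᵇ-⊔ʳ : ∀ j → isSingletonᵇ (fam AB (a ↑ʳ j)) ≡ isSingletonᵇ (fam B j)
  isSingletonᵇ-⊔ʳ j = cong (ℕ._≡ᵇ 1) (trans (ΣFin-+ (n A) (n B) (fam AB (a ↑ʳ j)))
    (cong₂ ℕ._+_ (ΣFin-zero (n A) _ (fam-⊔ʳˡ A B j)) (cong sum (LP.map-cong (fam-⊔ʳʳ A B j) (allFin (n B))))))

  module _ (S₁ : Subset a) (S₂ : Subset b) where
    private
      lookupˡ : ∀ i → Vec.lookup (S₁ Vec.++ S₂) (i ↑ˡ b) ≡ Vec.lookup S₁ i
      lookupˡ = VP.lookup-++ˡ S₁ S₂
      lookupʳ : ∀ j → Vec.lookup (S₁ Vec.++ S₂) (a ↑ʳ j) ≡ Vec.lookup S₂ j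
      lookupʳ = VP.lookup-++ʳ S₁ S₂

    isSubᵇ-⊔⁻ : isSubᵇ AB (S₁ Vec.++ S₂) ≡ true → isSubᵇ A S₁ ≡ true × isSubᵇ B S₂ ≡ true
    isSubᵇ-⊔⁻ h = let dc , sg = isSubᵇ⁻ AB (S₁ Vec.++ S₂) h in
      isSubᵇ⁺ A S₁ (λ i j p o → trans (sym (lookupˡ i)) (dc (i ↑ˡ b) (j ↑ˡ b) (trans (lookupˡ j) p) (trans (ord-⊔ˡˡ A B i j) o)))
                   (λ i s → trans (sym (lookupˡ i)) (sg (i ↑ˡ b) (trans (isSingletonᵇ-⊔ˡ i) s))) ,
      isSubᵇ⁺ B S₂ (λ i j p o → trans (sym (lookupʳ i)) (dc (a ↑ʳ i) (a ↑ʳ j) (trans (lookupʳ j) p) (trans (ord-⊔ʳʳ A B i j) o)))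
                   (λ i s → trans (sym (lookupʳ i)) (sg (a ↑ʳ i) (trans (isSingletonᵇ-⊔ʳ i) s)))

    isSubᵇ-⊔⁺ : isSubᵇ A S₁ ≡ true → isSubᵇ B S₂ ≡ true → isSubᵇ AB (S₁ Vec.++ S₂) ≡ true
    isSubᵇ-⊔⁺ h₁ h₂ = isSubᵇ⁺ AB (S₁ Vec.++ S₂) (λ i j → dc (splitView a b i) (splitView a b j))
                                               (λ i → sg (splitView a b i))
      where
      dc₁ = proj₁ (isSubᵇ⁻ A S₁ h₁)
      sg₁ = proj₂ (isSubᵇ⁻ A S₁ h₁)
      dc₂ = proj₁ (isSubᵇ⁻ B S₂ h₂)
      sg₂ = proj₂ (isSubᵇ⁻ B S₂ h₂)
      dc : ∀ {i j} → SplitView a b i → SplitView a b j →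
           Vec.lookup (S₁ Vec.++ S₂) j ≡ true → ord AB i j ≡ true → Vec.lookup (S₁ Vec.++ S₂) i ≡ true
      dc (left i)  (left j)  p o = trans (lookupˡ i) (dc₁ i j (trans (sym (lookupˡ j)) p) (trans (sym (ord-⊔ˡˡ A B i j)) o))
      dc (left i)  (right j) p o with () ← trans (sym o) (ord-⊔ˡʳ A B i j)
      dc (right i) (left j)  p o with () ← trans (sym o) (ord-⊔ʳˡ A B i j)
      dc (right i) (right j) p o = trans (lookupʳ i) (dc₂ i j (trans (sym (lookupʳ j)) p) (trans (sym (ord-⊔ʳʳ A B i j)) o))
      sg : ∀ {i} → SplitView a b i → isSingletonᵇ (fam AB i) ≡ true → Vec.lookup (S₁ Vec.++ S₂) i ≡ true
      sg (left i)  s = trans (lookupˡ i) (sg₁ i (trans (sym (isSingletonᵇ-⊔ˡ i)) s))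
      sg (right j) s = trans (lookupʳ j) (sg₂ j (trans (sym (isSingletonᵇ-⊔ʳ j)) s))

  ∈X-⊔⁻ : ∀ {F} → F ∈ X AB → Vec.take a F ∈ X A × Vec.drop a F ∈ X B
  ∈X-⊔⁻ {F} F∈ = let p , q = isSubᵇ-⊔⁻ (Vec.take a F) (Vec.drop a F)
                                (subst (λ z → isSubᵇ AB z ≡ true) (sym (VP.take++drop≡id a F)) (∈X⁻ AB F∈))
                  in ∈X⁺ A p , ∈X⁺ B q

  ∈X-⊔⁺ : ∀ {S₁ S₂} → S₁ ∈ X A → S₂ ∈ X B → (S₁ Vec.++ S₂) ∈ X AB
  ∈X-⊔⁺ {S₁} {S₂} S₁∈ S₂∈ = ∈X⁺ AB (isSubᵇ-⊔⁺ S₁ S₂ (∈X⁻ A S₁∈) (∈X⁻ B S₂∈))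

  X-⊔ : X AB ↭ cartesianProductWith Vec._++_ (X A) (X B)
  X-⊔ = unique∧same-elements⇒↭ (unique-X AB)
    (Unique.cartesianProductWith⁺ Vec._++_ (VP.++-injective _ _) (unique-X A) (unique-X B))
    (λ {F} F∈ → let p , q = ∈X-⊔⁻ F∈ in
       subst (_∈ cartesianProductWith Vec._++_ (X A) (X B)) (VP.take++drop≡id a F) (∈-cartesianProductWith⁺ Vec._++_ p q))
    (λ F∈ → case-∈ (∈-cartesianProductWith⁻ Vec._++_ (X A) (X B) F∈))
    where
    case-∈ : ∀ {F} → ∃[ S₁ ] ∃[ S₂ ] (S₁ ∈ X A × S₂ ∈ X B × F ≡ S₁ Vec.++ S₂) → F ∈ X AB
    case-∈ (_ , _ , S₁∈ , S₂∈ , refl) = ∈X-⊔⁺ S₁∈ S₂∈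

  μA = μ⋆ (X A)
  μB = μ⋆ (X B)

  μ× : Subset a → Subset b → Subset (a ℕ.+ b) → ℤ
  μ× D₁ D₂ F = μA D₁ (Vec.take a F) ℤ.* μB D₂ (Vec.drop a F)

  μ×-++ : ∀ D₁ D₂ (F₁ : Subset a) (F₂ : Subset b) → μ× D₁ D₂ (F₁ Vec.++ F₂) ≡ μA D₁ F₁ ℤ.* μB D₂ F₂
  μ×-++ D₁ D₂ F₁ F₂ = let p , q = take-drop-++ F₁ F₂ in cong₂ ℤ._*_ (cong (μA D₁) p) (cong (μB D₂) q)

  closedᵇ-++ : ∀ (D₁ E₁ S₁ : Subset a) (D₂ E₂ S₂ : Subset b) →
    closedᵇ (D₁ Vec.++ D₂) (E₁ Vec.++ E₂) (S₁ Vec.++ S₂) ≡ (closedᵇ D₁ E₁ S₁ ∧ closedᵇ D₂ E₂ S₂)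
  closedᵇ-++ D₁ E₁ S₁ D₂ E₂ S₂ rewrite ⊆ᵇ-++ D₁ S₁ D₂ S₂ | ⊆ᵇ-++ S₁ E₁ S₂ E₂ =
    ∧-interchange (D₁ ⊆ᵇ S₁) (D₂ ⊆ᵇ S₂) (S₁ ⊆ᵇ E₁) (S₂ ⊆ᵇ E₂)

  μ×-interval-sum : ∀ (D₁ E₁ : Subset a) (D₂ E₂ : Subset b) → E₁ ∈ X A → E₂ ∈ X B → (D₁ ⊆ᵇ E₁) ≡ true → (D₂ ⊆ᵇ E₂) ≡ true →
    sumℤ (map (μ× D₁ D₂) (filterᵇ (closedᵇ (D₁ Vec.++ D₂) (E₁ Vec.++ E₂)) (X AB))) ≡ δ D₁ E₁ ℤ.* δ D₂ E₂
  μ×-interval-sum D₁ E₁ D₂ E₂ E₁∈ E₂∈ D₁⊆E₁ D₂⊆E₂ = begin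
    sumℤ (map (μ× D₁ D₂) (filterᵇ (closedᵇ D E) (X AB)))
      ≡⟨ sumℤ-↭ (PermP.map⁺ (μ× D₁ D₂) (filterᵇ-↭ (closedᵇ D E) X-⊔)) ⟩
    sumℤ (map (μ× D₁ D₂) (filterᵇ (closedᵇ D E) (cartesianProductWith Vec._++_ (X A) (X B))))
      ≡⟨ cong (sumℤ ∘ map (μ× D₁ D₂))
              (filterᵇ-cartesianProduct (closedᵇ D₁ E₁) (closedᵇ D₂ E₂) (closedᵇ D E) (λ S₁ S₂ → closedᵇ-++ D₁ E₁ S₁ D₂ E₂ S₂) (X A) (X B)) ⟩
    sumℤ (map (μ× D₁ D₂) (cartesianProductWith Vec._++_ (filterᵇ (closedᵇ D₁ E₁) (X A)) (filterᵇ (closedᵇ D₂ E₂) (X B))))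
      ≡⟨ sumℤ-cartesianProduct (μA D₁) (μB D₂) (μ× D₁ D₂) (μ×-++ D₁ D₂) (filterᵇ (closedᵇ D₁ E₁) (X A)) (filterᵇ (closedᵇ D₂ E₂) (X B)) ⟩
    sumℤ (map (μA D₁) (filterᵇ (closedᵇ D₁ E₁) (X A))) ℤ.* sumℤ (map (μB D₂) (filterᵇ (closedᵇ D₂ E₂) (X B)))
      ≡⟨ cong₂ ℤ._*_ (μ⋆-interval-sum (X A) D₁ E₁ (unique-X A) E₁∈ D₁⊆E₁)
                     (μ⋆-interval-sum (X B) D₂ E₂ (unique-X B) E₂∈ D₂⊆E₂) ⟩
    δ D₁ E₁ ℤ.* δ D₂ E₂ ∎
    where
    open ≡-Reasoning
    D = D₁ Vec.++ D₂
    E = E₁ Vec.++ E₂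

  -- Induction on the fuel; in the strict case the interval sum of μ×
  -- vanishes, which is exactly the recursion satisfied by μ on X (A ⊔ B).
  μL-⊔ : ∀ t (D₁ E₁ : Subset a) (D₂ E₂ : Subset b) → E₁ ∈ X A → E₂ ∈ X B → count (E₁ Vec.++ E₂) < t →
    μL (X AB) t (D₁ Vec.++ D₂) (E₁ Vec.++ E₂) ≡ μA D₁ E₁ ℤ.* μB D₂ E₂
  μL-⊔ (suc t) D₁ E₁ D₂ E₂ E₁∈ E₂∈ (s≤s lt) =
    bool-cases (D ==ᵇ E) equal (λ D≠E → bool-cases (D ⊆ᵇ E) (strict D≠E) incomparable)
    where
    D = D₁ Vec.++ D₂
    E = E₁ Vec.++ E₂

    equal : (D ==ᵇ E) ≡ true → μL (X AB) (suc t) D E ≡ μA D₁ E₁ ℤ.* μB D₂ E₂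
    equal D=E = let D₁=E₁ , D₂=E₂ = ∧≡true⁻ (trans (sym (==ᵇ-++ D₁ E₁ D₂ E₂)) D=E) in
      trans (μL-refl (X AB) t D E D=E)
            (sym (cong₂ ℤ._*_ (μL-refl (X A) a D₁ E₁ D₁=E₁) (μL-refl (X B) b D₂ E₂ D₂=E₂)))

    incomparable : (D ⊆ᵇ E) ≡ false → μL (X AB) (suc t) D E ≡ μA D₁ E₁ ℤ.* μB D₂ E₂
    incomparable D⊈E = trans (μL-⊈ (X AB) t D E D⊈E) (bool-cases (D₁ ⊆ᵇ E₁)
      (λ D₁⊆E₁ → let D₂⊈E₂ = trans (sym (cong (_∧ (D₂ ⊆ᵇ E₂)) D₁⊆E₁)) (trans (sym (⊆ᵇ-++ D₁ E₁ D₂ E₂)) D⊈E) in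
         sym (trans (cong (μA D₁ E₁ ℤ.*_) (μL-⊈ (X B) b D₂ E₂ D₂⊈E₂)) (ℤP.*-zeroʳ (μA D₁ E₁))))
      (λ D₁⊈E₁ → sym (trans (cong (ℤ._* μB D₂ E₂) (μL-⊈ (X A) a D₁ E₁ D₁⊈E₁)) (ℤP.*-zeroˡ (μB D₂ E₂)))))

    strict : (D ==ᵇ E) ≡ false → (D ⊆ᵇ E) ≡ true → μL (X AB) (suc t) D E ≡ μA D₁ E₁ ℤ.* μB D₂ E₂
    strict D≠E D⊆E = begin
      μL (X AB) (suc t) D E                                   ≡⟨ μL-step (X AB) t D E D≠E D⊆E ⟩
      ℤ.- sumℤ (map (μL (X AB) t D) below)                   ≡⟨ cong (ℤ.-_ ∘ sumℤ) (map-cong-∈ below IH) ⟩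
      ℤ.- sumℤ (map (μ× D₁ D₂) below)                        ≡⟨ +-inverseˡ-unique _ _ closed-sum-zero ⟨
      μ× D₁ D₂ E                                             ≡⟨ μ×-++ D₁ D₂ E₁ E₂ ⟩
      μA D₁ E₁ ℤ.* μB D₂ E₂                                  ∎
      where
      open ≡-Reasoning
      below = filterᵇ (halfOpenᵇ D E) (X AB)
      D₁⊆E₁ = proj₁ (∧≡true⁻ (trans (sym (⊆ᵇ-++ D₁ E₁ D₂ E₂)) D⊆E))
      D₂⊆E₂ = proj₂ (∧≡true⁻ (trans (sym (⊆ᵇ-++ D₁ E₁ D₂ E₂)) D⊆E))

      IH : ∀ F → F ∈ below → μL (X AB) t D F ≡ μ× D₁ D₂ F
      IH F F∈ = let F∈X , F∈below = ∈-filterᵇ⁻ (halfOpenᵇ D E) (X AB) F∈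
                    F₁∈ , F₂∈ = ∈X-⊔⁻ F∈X
                    F≡ = sym (VP.take++drop≡id a F) in
        trans (cong (μL (X AB) t D) F≡)
              (μL-⊔ t D₁ (Vec.take a F) D₂ (Vec.drop a F) F₁∈ F₂∈
                    (ℕP.<-≤-trans (subst (λ z → count z < count E) F≡ (halfOpenᵇ-count D E F F∈below)) lt))

      δδ≡0 : δ D₁ E₁ ℤ.* δ D₂ E₂ ≡ 0ℤ
      δδ≡0 with D₁ ==ᵇ E₁ in e₁ | D₂ ==ᵇ E₂ in e₂
      ... | false | _     = refl
      ... | true  | false = refl
      ... | true  | true  = ⊥-elim (true≢false (trans (sym (trans (==ᵇ-++ D₁ E₁ D₂ E₂) (cong₂ _∧_ e₁ e₂))) D≠E))

      closed-sum-zero : μ× D₁ D₂ E ℤ.+ sumℤ (map (μ× D₁ D₂) below) ≡ 0ℤ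
      closed-sum-zero = begin
        μ× D₁ D₂ E ℤ.+ sumℤ (map (μ× D₁ D₂) below)
          ≡⟨ sumℤ-↭ (PermP.map⁺ (μ× D₁ D₂) (closedᵇ-split (X AB) D E (unique-X AB) (∈X-⊔⁺ E₁∈ E₂∈) D⊆E)) ⟨
        sumℤ (map (μ× D₁ D₂) (filterᵇ (closedᵇ D E) (X AB)))
          ≡⟨ μ×-interval-sum D₁ E₁ D₂ E₂ E₁∈ E₂∈ D₁⊆E₁ D₂⊆E₂ ⟩
        δ D₁ E₁ ℤ.* δ D₂ E₂
          ≡⟨ δδ≡0 ⟩
        0ℤ ∎

  module _ (S₁ : Subset a) (S₂ : Subset b) where
    private
      module S₁₂ = Selection (Vec.lookup (S₁ Vec.++ S₂))
      module Sel₁ = Selection (Vec.lookup S₁)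
      module Sel₂ = Selection (Vec.lookup S₂)
      c₁ = Sel₁.c
      c₂ = Sel₂.c
      A₁ = restrict A S₁
      B₂ = restrict B S₂

      ι⊔ : Fin (c₁ ℕ.+ c₂) → Fin (a ℕ.+ b)
      ι⊔ i = join a b (Sum.map Sel₁.ι Sel₂.ι (splitAt c₁ i))

      ι⊔-↑ˡ : ∀ i → ι⊔ (i ↑ˡ c₂) ≡ Sel₁.ι i ↑ˡ b
      ι⊔-↑ˡ i rewrite FP.splitAt-↑ˡ c₁ i c₂ = refl

      ι⊔-↑ʳ : ∀ j → ι⊔ (c₁ ↑ʳ j) ≡ a ↑ʳ Sel₂.ι j
      ι⊔-↑ʳ j rewrite FP.splitAt-↑ʳ c₁ c₂ j = refl

      fam-ι⊔ : ∀ i k → fam (A₁ ⊔ B₂) i k ≡ fam AB (ι⊔ i) k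
      fam-ι⊔ i k with splitView c₁ c₂ i | splitView (n A) (n B) k
      ... | left i'  | left k'  rewrite ι⊔-↑ˡ i' = trans (fam-⊔ˡˡ A₁ B₂ i' k') (sym (fam-⊔ˡˡ A B (Sel₁.ι i') k'))
      ... | left i'  | right k' rewrite ι⊔-↑ˡ i' = trans (fam-⊔ˡʳ A₁ B₂ i' k') (sym (fam-⊔ˡʳ A B (Sel₁.ι i') k'))
      ... | right i' | left k'  rewrite ι⊔-↑ʳ i' = trans (fam-⊔ʳˡ A₁ B₂ i' k') (sym (fam-⊔ʳˡ A B (Sel₂.ι i') k'))
      ... | right i' | right k' rewrite ι⊔-↑ʳ i' = trans (fam-⊔ʳʳ A₁ B₂ i' k') (sym (fam-⊔ʳʳ A B (Sel₂.ι i') k'))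

      ord-ι⊔ : ∀ i j → ord (A₁ ⊔ B₂) i j ≡ ord AB (ι⊔ i) (ι⊔ j)
      ord-ι⊔ i j with splitView c₁ c₂ i | splitView c₁ c₂ j
      ... | left i'  | left j'  rewrite ι⊔-↑ˡ i' | ι⊔-↑ˡ j' = trans (ord-⊔ˡˡ A₁ B₂ i' j') (sym (ord-⊔ˡˡ A B _ _))
      ... | left i'  | right j' rewrite ι⊔-↑ˡ i' | ι⊔-↑ʳ j' = trans (ord-⊔ˡʳ A₁ B₂ i' j') (sym (ord-⊔ˡʳ A B _ _))
      ... | right i' | left j'  rewrite ι⊔-↑ʳ i' | ι⊔-↑ˡ j' = trans (ord-⊔ʳˡ A₁ B₂ i' j') (sym (ord-⊔ʳˡ A B _ _))
      ... | right i' | right j' rewrite ι⊔-↑ʳ i' | ι⊔-↑ʳ j' = trans (ord-⊔ʳʳ A₁ B₂ i' j') (sym (ord-⊔ʳʳ A B _ _))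

      ι⊔-injective : ∀ i j → ι⊔ i ≡ ι⊔ j → i ≡ j
      ι⊔-injective i j e with splitView c₁ c₂ i | splitView c₁ c₂ j
      ... | left i'  | left j'  rewrite ι⊔-↑ˡ i' | ι⊔-↑ˡ j' = cong (_↑ˡ c₂) (Sel₁.ι-injective _ _ (FP.↑ˡ-injective b _ _ e))
      ... | left i'  | right j' rewrite ι⊔-↑ˡ i' | ι⊔-↑ʳ j' = ⊥-elim (↑ˡ≢↑ʳ _ _ e)
      ... | right i' | left j'  rewrite ι⊔-↑ʳ i' | ι⊔-↑ˡ j' = ⊥-elim (↑ˡ≢↑ʳ _ _ (sym e))
      ... | right i' | right j' rewrite ι⊔-↑ʳ i' | ι⊔-↑ʳ j' = cong (c₁ ↑ʳ_) (Sel₂.ι-injective _ _ (FP.↑ʳ-injective a _ _ e))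

      ι⊔-preimage : ∀ k → Vec.lookup (S₁ Vec.++ S₂) k ≡ true → Σ (Fin (c₁ ℕ.+ c₂)) (λ j → ι⊔ j ≡ k)
      ι⊔-preimage k = on-side (splitView a b k)
        where
        on-side : ∀ {k} → SplitView a b k → Vec.lookup (S₁ Vec.++ S₂) k ≡ true → Σ (Fin (c₁ ℕ.+ c₂)) (λ j → ι⊔ j ≡ k)
        on-side (left k) p = let q = trans (sym (VP.lookup-++ˡ S₁ S₂ k)) p in
          Sel₁.ρ k q ↑ˡ c₂ , trans (ι⊔-↑ˡ _) (cong (_↑ˡ b) (Sel₁.ι∘ρ k q))
        on-side (right k) p = let q = trans (sym (VP.lookup-++ʳ S₁ S₂ k)) p in
          c₁ ↑ʳ Sel₂.ρ k q , trans (ι⊔-↑ʳ _) (cong (a ↑ʳ_) (Sel₂.ι∘ρ k q))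

      ι⊔-∈ : ∀ j → Vec.lookup (S₁ Vec.++ S₂) (ι⊔ j) ≡ true
      ι⊔-∈ j with splitView c₁ c₂ j
      ... | left i  rewrite ι⊔-↑ˡ i = trans (VP.lookup-++ˡ S₁ S₂ _) (Sel₁.ι-π i)
      ... | right i rewrite ι⊔-↑ʳ i = trans (VP.lookup-++ʳ S₁ S₂ _) (Sel₂.ι-π i)

    restrict-⊔ : restrict AB (S₁ Vec.++ S₂) ≅ (A₁ ⊔ B₂)
    restrict-⊔ = record
      { σ = ↔-refl
      ; τ = ↔-from-same-image S₁₂.ι ι⊔ S₁₂.ι-injective ι⊔-injective f f-ok g g-ok
      ; fam-resp = λ i k → trans (fam-ι⊔ (f i) k) (cong (λ z → fam AB z k) (f-ok i))
      ; ord-resp = λ i j → trans (ord-ι⊔ (f i) (f j)) (cong₂ (ord AB) (f-ok i) (f-ok j)) }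
      where
      f : Fin S₁₂.c → Fin (c₁ ℕ.+ c₂)
      f i = proj₁ (ι⊔-preimage (S₁₂.ι i) (S₁₂.ι-π i))
      f-ok : ∀ i → ι⊔ (f i) ≡ S₁₂.ι i
      f-ok i = proj₂ (ι⊔-preimage (S₁₂.ι i) (S₁₂.ι-π i))
      g : Fin (c₁ ℕ.+ c₂) → Fin S₁₂.c
      g j = S₁₂.ρ (ι⊔ j) (ι⊔-∈ j)
      g-ok : ∀ j → S₁₂.ι (g j) ≡ ι⊔ j
      g-ok j = S₁₂.ι∘ρ _ _

  μP-⊔ : ∀ S₁ S₂ → μP AB (S₁ Vec.++ S₂) (full (a ℕ.+ b)) ≡ μP A S₁ (full a) ℤ.* μP B S₂ (full b)
  μP-⊔ S₁ S₂ = begin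
    μP AB (S₁ Vec.++ S₂) (full (a ℕ.+ b))                 ≡⟨ μ-fuel≡μL AB (suc (a ℕ.+ b)) (S₁ Vec.++ S₂) (full (a ℕ.+ b)) ⟩
    μL (X AB) (suc (a ℕ.+ b)) (S₁ Vec.++ S₂) (full (a ℕ.+ b))
      ≡⟨ cong (μL (X AB) (suc (a ℕ.+ b)) (S₁ Vec.++ S₂)) (full-++ a b) ⟩
    μL (X AB) (suc (a ℕ.+ b)) (S₁ Vec.++ S₂) (full a Vec.++ full b)
      ≡⟨ μL-⊔ (suc (a ℕ.+ b)) S₁ (full a) S₂ (full b) (full∈X A) (full∈X B)
              (s≤s (subst (_≤ a ℕ.+ b) (cong count (full-++ a b)) (count-≤ (full (a ℕ.+ b))))) ⟩
    μA S₁ (full a) ℤ.* μB S₂ (full b)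
      ≡⟨ cong₂ ℤ._*_ (μ-fuel≡μL A (suc a) S₁ (full a)) (μ-fuel≡μL B (suc b) S₂ (full b)) ⟨
    μP A S₁ (full a) ℤ.* μP B S₂ (full b)                 ∎
    where open ≡-Reasoning

  P-⊔ : P AB ∼ (P A *H P B)
  P-⊔ = begin
    map termAB (X AB)
      ≈⟨ ↭⇒∼ (PermP.map⁺ termAB X-⊔) ⟩
    map termAB (cartesianProductWith Vec._++_ (X A) (X B))
      ≈⟨ ≡⇒∼ (map-cartesianProductWith termAB Vec._++_ (X A) (X B)) ⟩
    concatMap (λ S₁ → map (λ S₂ → termAB (S₁ Vec.++ S₂)) (X B)) (X A)
      ≈⟨ concatMap-cong-∼ _ _ (X A) (λ S₁ _ → map-cong-∼ _ _ (X B) (λ S₂ _ → μP-⊔ S₁ S₂ , restrict-⊔ S₁ S₂)) ⟩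
    concatMap (λ S₁ → map (λ S₂ → (μP A S₁ (full a) ℤ.* μP B S₂ (full b) , restrict A S₁ ⊔ restrict B S₂)) (X B)) (X A)
      ≈⟨ ≡⇒∼ (trans (cong concat (sym (LP.map-∘ (X A)))) (LP.concatMap-cong (λ S₁ → sym (LP.map-∘ (X B))) (X A))) ⟨
    P A *H P B ∎
    where
    open ∼-Reasoning
    termAB : Subset (a ℕ.+ b) → ℤ × Raw
    termAB S = μP AB S (full (a ℕ.+ b)) , restrict AB S

-- Invariance of P under isomorphism

↔-injective : (f : A ↔ B) → ∀ {x y} → Inverse.to f x ≡ Inverse.to f y → x ≡ y
↔-injective f = Injection.injective (↔⇒↣ f)

ΣFin-↔ : ∀ {a b} (σ : Fin a ↔ Fin b) (g : Fin b → ℕ) → ΣFin (g ∘ Inverse.to σ) ≡ ΣFin g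
ΣFin-↔ {a} {b} σ g = trans (cong sum (LP.map-∘ (allFin a))) (ℕLP.sum-↭ (PermP.map⁺ g
  (unique∧same-elements⇒↭ (Unique.map⁺ (↔-injective σ) (Unique.allFin⁺ a)) (Unique.allFin⁺ b)
     (λ {z} _ → ∈-allFin z)
     (λ {z} _ → subst (_∈ map (Inverse.to σ) (allFin a)) (Inverse.strictlyInverseˡ σ z)
                      (∈-map⁺ _ (∈-allFin (Inverse.from σ z)))))))

module IsoInvariance {R R' : Raw} (I : R ≅ R') where
  open _≅_ I
  open Inverse

  relabel : Subset (m R) → Subset (m R')
  relabel S = Vec.tabulate (λ j → Vec.lookup S (from τ j))

  unrelabel : Subset (m R') → Subset (m R)
  unrelabel S' = Vec.tabulate (λ i → Vec.lookup S' (to τ i))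

  lookup-relabel : ∀ S j → Vec.lookup (relabel S) j ≡ Vec.lookup S (from τ j)
  lookup-relabel S j = VP.lookup∘tabulate _ j

  lookup-relabel-to : ∀ S i → Vec.lookup (relabel S) (to τ i) ≡ Vec.lookup S i
  lookup-relabel-to S i = trans (lookup-relabel S (to τ i)) (cong (Vec.lookup S) (strictlyInverseʳ τ i))

  relabel-⊆ᵇ : ∀ S T → (relabel S ⊆ᵇ relabel T) ≡ (S ⊆ᵇ T)
  relabel-⊆ᵇ S T = bool-ext
    (λ h → ⊆ᵇ⁺ S T (λ i p → trans (sym (lookup-relabel-to T i))
                              (⊆ᵇ⁻ (relabel S) (relabel T) h (to τ i) (trans (lookup-relabel-to S i) p))))
    (λ h → ⊆ᵇ⁺ (relabel S) (relabel T) (λ j p → trans (lookup-relabel T j)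
                              (⊆ᵇ⁻ S T h (from τ j) (trans (sym (lookup-relabel S j)) p))))

  relabel-injective : ∀ S T → relabel S ≡ relabel T → S ≡ T
  relabel-injective S T h = vec-ext S T (λ i →
    trans (sym (lookup-relabel-to S i)) (trans (cong (λ z → Vec.lookup z (to τ i)) h) (lookup-relabel-to T i)))

  relabel-unrelabel : ∀ S' → relabel (unrelabel S') ≡ S'
  relabel-unrelabel S' = vec-ext _ S' (λ j → trans (lookup-relabel (unrelabel S') j)
    (trans (VP.lookup∘tabulate _ (from τ j)) (cong (Vec.lookup S') (strictlyInverseˡ τ j))))

  relabel-full : relabel (full (m R)) ≡ full (m R')
  relabel-full = vec-ext _ _ (λ j → trans (lookup-relabel (full (m R)) j)
    (trans (lookup-full (from τ j)) (sym (lookup-full j))))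

  isSingletonᵇ-resp : ∀ i → isSingletonᵇ (fam R' (to τ i)) ≡ isSingletonᵇ (fam R i)
  isSingletonᵇ-resp i = cong (ℕ._≡ᵇ 1) (trans (sym (ΣFin-↔ σ (fam R' (to τ i))))
    (cong sum (LP.map-cong (fam-resp i) (allFin (n R)))))

  isSubᵇ-relabel : ∀ S → isSubᵇ R' (relabel S) ≡ isSubᵇ R S
  isSubᵇ-relabel S = bool-ext to′ from′
    where
    to′ : isSubᵇ R' (relabel S) ≡ true → isSubᵇ R S ≡ true
    to′ h = let dc , sg = isSubᵇ⁻ R' (relabel S) h in isSubᵇ⁺ R S
      (λ i j p o → trans (sym (lookup-relabel-to S i))
                         (dc (to τ i) (to τ j) (trans (lookup-relabel-to S j) p) (trans (ord-resp i j) o)))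
      (λ i s → trans (sym (lookup-relabel-to S i)) (sg (to τ i) (trans (isSingletonᵇ-resp i) s)))
    from′ : isSubᵇ R S ≡ true → isSubᵇ R' (relabel S) ≡ true
    from′ h = let dc , sg = isSubᵇ⁻ R S h in isSubᵇ⁺ R' (relabel S)
      (λ i j p o → trans (lookup-relabel S i) (dc (from τ i) (from τ j) (trans (sym (lookup-relabel S j)) p)
          (trans (sym (ord-resp (from τ i) (from τ j))) (trans (cong₂ (ord R') (strictlyInverseˡ τ i) (strictlyInverseˡ τ j)) o))))
      (λ i s → trans (lookup-relabel S i) (sg (from τ i) (trans (sym (isSingletonᵇ-resp (from τ i)))
          (trans (cong (λ z → isSingletonᵇ (fam R' z)) (strictlyInverseˡ τ i)) s))))

  X-relabel : map relabel (X R) ↭ X R'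
  X-relabel = unique∧same-elements⇒↭ (Unique.map⁺ (relabel-injective _ _) (unique-X R)) (unique-X R') to′ from′
    where
    to′ : ∀ {z} → z ∈ map relabel (X R) → z ∈ X R'
    to′ z∈ with ∈-map⁻ relabel z∈
    ... | S , S∈ , refl = ∈X⁺ R' (trans (isSubᵇ-relabel S) (∈X⁻ R S∈))
    from′ : ∀ {z} → z ∈ X R' → z ∈ map relabel (X R)
    from′ {z} z∈ = subst (_∈ map relabel (X R)) (relabel-unrelabel z) (∈-map⁺ relabel (∈X⁺ R {unrelabel z}
      (trans (sym (isSubᵇ-relabel (unrelabel z))) (trans (cong (isSubᵇ R') (relabel-unrelabel z)) (∈X⁻ R' z∈)))))

  X-relabel-halfOpen : ∀ D E → D ∈ X R → E ∈ X R →
    filterᵇ (halfOpenᵇ (relabel D) (relabel E)) (X R') ↭ map relabel (filterᵇ (halfOpenᵇ D E) (X R))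
  X-relabel-halfOpen D E _ _ = Perm.trans (filterᵇ-↭ _ (Perm.↭-sym X-relabel))
    (Perm.↭-reflexive (trans (filterᵇ-map _ relabel (X R)) (cong (map relabel) (filterᵇ-cong-∈ (X R) (λ F _ → relabel-halfOpen F)))))
    where
    relabel-halfOpen : ∀ F → halfOpenᵇ (relabel D) (relabel E) (relabel F) ≡ halfOpenᵇ D E F
    relabel-halfOpen F rewrite relabel-⊆ᵇ D F | relabel-⊆ᵇ F E | relabel-⊆ᵇ E F = refl

  μP-relabel : ∀ S → S ∈ X R → μP R' (relabel S) (full (m R')) ≡ μP R S (full (m R))
  μP-relabel S S∈ = begin
    μP R' (relabel S) (full (m R'))                   ≡⟨ μ-fuel≡μL R' (suc (m R')) (relabel S) (full (m R')) ⟩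
    μL (X R') (suc (m R')) (relabel S) (full (m R'))  ≡⟨ cong (μL (X R') (suc (m R')) (relabel S)) relabel-full ⟨
    μL (X R') (suc (m R')) (relabel S) (relabel (full (m R)))
      ≡⟨ μL-transfer (X R) (X R') relabel (λ a b _ _ → relabel-⊆ᵇ a b) X-relabel-halfOpen (suc (m R')) S (full (m R)) S∈ (full∈X R) ⟩
    μL (X R) (suc (m R')) S (full (m R))
      ≡⟨ μ⋆≡μL (X R) (suc (m R')) S (full (m R)) (s≤s (ℕP.≤-trans (count-≤ (full (m R))) (FP.injective⇒≤ (↔-injective τ)))) ⟨
    μ⋆ (X R) S (full (m R))                           ≡⟨ μ-fuel≡μL R (suc (m R)) S (full (m R)) ⟨
    μP R S (full (m R))                               ∎
    where open ≡-Reasoning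

  restrict-relabel : ∀ S → restrict R S ≅ restrict R' (relabel S)
  restrict-relabel S = record
    { σ = σ
    ; τ = ↔-from-same-image ι₁ Sel'.ι ι₁-injective Sel'.ι-injective f f-ok g g-ok
    ; fam-resp = λ i k → trans (cong (λ z → fam R' z (to σ k)) (f-ok i)) (fam-resp (Sel.ι i) k)
    ; ord-resp = λ i j → trans (cong₂ (ord R') (f-ok i) (f-ok j)) (ord-resp (Sel.ι i) (Sel.ι j)) }
    where
    module Sel  = Selection (Vec.lookup S)
    module Sel' = Selection (Vec.lookup (relabel S))
    ι₁ : Fin Sel.c → Fin (m R')
    ι₁ i = to τ (Sel.ι i)
    ι₁-injective : ∀ a b → ι₁ a ≡ ι₁ b → a ≡ b
    ι₁-injective a b h = Sel.ι-injective a b (↔-injective τ h)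
    f : Fin Sel.c → Fin Sel'.c
    f i = Sel'.ρ (ι₁ i) (trans (lookup-relabel-to S (Sel.ι i)) (Sel.ι-π i))
    f-ok : ∀ i → Sel'.ι (f i) ≡ ι₁ i
    f-ok i = Sel'.ι∘ρ _ _
    g : Fin Sel'.c → Fin Sel.c
    g j = Sel.ρ (from τ (Sel'.ι j)) (trans (sym (lookup-relabel S (Sel'.ι j))) (Sel'.ι-π j))
    g-ok : ∀ j → ι₁ (g j) ≡ Sel'.ι j
    g-ok j = trans (cong (to τ) (Sel.ι∘ρ _ _)) (strictlyInverseˡ τ _)

  P-resp-≅ : P R ∼ P R'
  P-resp-≅ =
    ∼-trans (map-cong-∼ _ (λ S → (μP R' (relabel S) (full (m R')) , restrict R' (relabel S))) (X R)
                        (λ S S∈ → sym (μP-relabel S S∈) , restrict-relabel S))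
      (∼-trans (≡⇒∼ (LP.map-∘ (X R))) (↭⇒∼ (PermP.map⁺ _ X-relabel)))

-- Connected components

module Partition {N : ℕ} (π : Fin N → Bool) where
  module Sel₁ = Selection π
  module Sel₂ = Selection (not ∘ π)
  c₁ = Sel₁.c
  c₂ = Sel₂.c

  ι⊎ : Fin (c₁ ℕ.+ c₂) → Fin N
  ι⊎ i = Sum.[ Sel₁.ι , Sel₂.ι ]′ (splitAt c₁ i)

  ι⊎-↑ˡ : ∀ i → ι⊎ (i ↑ˡ c₂) ≡ Sel₁.ι i
  ι⊎-↑ˡ i rewrite FP.splitAt-↑ˡ c₁ i c₂ = refl

  ι⊎-↑ʳ : ∀ j → ι⊎ (c₁ ↑ʳ j) ≡ Sel₂.ι j
  ι⊎-↑ʳ j rewrite FP.splitAt-↑ʳ c₁ c₂ j = refl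

  ι⊎-injective : ∀ i j → ι⊎ i ≡ ι⊎ j → i ≡ j
  ι⊎-injective i j e with splitView c₁ c₂ i | splitView c₁ c₂ j
  ... | left i'  | left j'  rewrite ι⊎-↑ˡ i' | ι⊎-↑ˡ j' = cong (_↑ˡ c₂) (Sel₁.ι-injective _ _ e)
  ... | left i'  | right j' rewrite ι⊎-↑ˡ i' | ι⊎-↑ʳ j' =
    ⊥-elim (true≢false (trans (sym (Sel₁.ι-π i')) (trans (cong π e) (not≡true⁻ (Sel₂.ι-π j')))))
  ... | right i' | left j'  rewrite ι⊎-↑ʳ i' | ι⊎-↑ˡ j' =
    ⊥-elim (true≢false (trans (sym (Sel₁.ι-π j')) (trans (cong π (sym e)) (not≡true⁻ (Sel₂.ι-π i')))))
  ... | right i' | right j' rewrite ι⊎-↑ʳ i' | ι⊎-↑ʳ j' = cong (c₁ ↑ʳ_) (Sel₂.ι-injective _ _ e)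

  ι⊎-preimage : ∀ k → Σ (Fin (c₁ ℕ.+ c₂)) (λ j → ι⊎ j ≡ k)
  ι⊎-preimage k = bool-cases (π k)
    (λ p → Sel₁.ρ k p ↑ˡ c₂ , trans (ι⊎-↑ˡ _) (Sel₁.ι∘ρ k p))
    (λ p → c₁ ↑ʳ Sel₂.ρ k (cong not p) , trans (ι⊎-↑ʳ _) (Sel₂.ι∘ρ k (cong not p)))

  ↔-partition : Fin N ↔ Fin (c₁ ℕ.+ c₂)
  ↔-partition = ↔-from-same-image id ι⊎ (λ _ _ h → h) ι⊎-injective
                  (proj₁ ∘ ι⊎-preimage) (proj₂ ∘ ι⊎-preimage) ι⊎ (λ _ → refl)

  ι⊎-↔-partition : ∀ k → ι⊎ (Inverse.to ↔-partition k) ≡ k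
  ι⊎-↔-partition k = proj₂ (ι⊎-preimage k)

Saturated : (R : Raw) → (Fin (n R) → Bool) → Set
Saturated R π = ∀ i a b → 0 < fam R i a → 0 < fam R i b → π a ≡ true → π b ≡ true

Saturated-not : ∀ R π → Saturated R π → Saturated R (not ∘ π)
Saturated-not R π sat i a b pa pb q with π a in ea | π b in eb
... | false | false = refl
... | false | true  = ⊥-elim (true≢false (trans (sym (sat i b a pb pa eb)) ea))

-- The piece of R lying over π: the points where π holds and the members meeting them.
module Piece (R : Raw) (mc : IsMultiComplex R) (π : Fin (n R) → Bool) (sat : Saturated R π) where
  open IsMultiComplex mc

  witness : Fin (m R) → Fin (n R)
  witness i = proj₁ (nonempty i)

  witness-pos : ∀ i → 0 < fam R i (witness i)
  witness-pos i = proj₂ (nonempty i)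

  side : Fin (m R) → Bool
  side i = π (witness i)

  side-support : ∀ i k → 0 < fam R i k → π k ≡ side i
  side-support i k pos = bool-ext (sat i k (witness i) pos (witness-pos i)) (sat i (witness i) k (witness-pos i) pos)

  fam-off-side : ∀ i k → π k ≢ side i → fam R i k ≡ 0
  fam-off-side i k ne with fam R i k in e
  ... | zero  = refl
  ... | suc _ = ⊥-elim (ne (side-support i k (subst (0 <_) (sym e) (s≤s z≤n))))

  ord-side : ∀ i j → ord R i j ≡ true → side i ≡ side j
  ord-side i j o = side-support j (witness i)
    (ℕP.<-≤-trans (witness-pos i) (ord-contained i j (≡true⇒T o) (witness i)))

  module Pts = Selection π
  module Mem = Selection side

  piece : Raw
  piece = record { n = Pts.c ; m = Mem.c
                 ; fam = λ i k → fam R (Mem.ι i) (Pts.ι k) ; ord = λ i j → ord R (Mem.ι i) (Mem.ι j) }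

  IsSingleton-lift : ∀ k j → IsSingleton k (fam piece j) → IsSingleton (Pts.ι k) (fam R (Mem.ι j))
  IsSingleton-lift k j sg x = bool-cases (π x)
    (λ p → trans (cong (fam R (Mem.ι j)) (sym (Pts.ι∘ρ x p)))
       (trans (sg (Pts.ρ x p)) (cong (λ b → if b then 1 else 0)
          (trans (sym (isYes-≟-injective Pts.ι Pts.ι-injective k (Pts.ρ x p)))
                 (cong (λ y → isYes (Pts.ι k ≟ y)) (Pts.ι∘ρ x p))))))
    (λ p → trans (fam-off-side (Mem.ι j) x (λ e → true≢false (trans (sym (Mem.ι-π j)) (trans (sym e) p))))
       (sym (cong (λ b → if b then 1 else 0)
          (isYes-false (Pts.ι k ≟ x) (λ e → true≢false (trans (sym (Pts.ι-π k)) (trans (cong π e) p)))))))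

  piece-isMultiComplex : IsMultiComplex piece
  piece-isMultiComplex = record
    { nonempty = λ i → let p = Mem.ι-π i in Pts.ρ (witness (Mem.ι i)) p ,
                       subst (λ z → 0 < fam R (Mem.ι i) z) (sym (Pts.ι∘ρ _ p)) (witness-pos (Mem.ι i))
    ; ord-refl = λ i → ord-refl (Mem.ι i)
    ; ord-antisym = λ i j p q → Mem.ι-injective i j (ord-antisym (Mem.ι i) (Mem.ι j) p q)
    ; ord-trans = λ i j l p q → ord-trans (Mem.ι i) (Mem.ι j) (Mem.ι l) p q
    ; singleton-unique = singleton-unique′
    ; singleton-ord = λ k i j sg → singleton-ord (Pts.ι k) (Mem.ι i) (Mem.ι j) (IsSingleton-lift k i sg)
    ; ord-contained = λ i j p k → ord-contained (Mem.ι i) (Mem.ι j) p (Pts.ι k) }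
    where
    singleton-unique′ : ∀ k → Σ (Fin Mem.c) λ i → IsSingleton k (fam piece i) × (∀ j → IsSingleton k (fam piece j) → j ≡ i)
    singleton-unique′ k with singleton-unique (Pts.ι k)
    ... | i , sg , uq =
      let one : fam R i (Pts.ι k) ≡ 1
          one = trans (sg (Pts.ι k)) (cong (λ b → if b then 1 else 0) (isYes-true (Pts.ι k ≟ Pts.ι k) refl))
          on-side : side i ≡ true
          on-side = trans (sym (side-support i (Pts.ι k) (subst (0 <_) (sym one) (s≤s z≤n)))) (Pts.ι-π k)
      in Mem.ρ i on-side ,
         (λ k' → trans (cong (λ z → fam R z (Pts.ι k')) (Mem.ι∘ρ i on-side))
                   (trans (sg (Pts.ι k')) (cong (λ b → if b then 1 else 0) (isYes-≟-injective Pts.ι Pts.ι-injective k k')))) ,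
         (λ j sj → Mem.ι-injective j (Mem.ρ i on-side) (trans (uq (Mem.ι j) (IsSingleton-lift k j sj)) (sym (Mem.ι∘ρ i on-side))))

module Splitting (R : Raw) (mc : IsMultiComplex R) (π : Fin (n R) → Bool) (sat : Saturated R π) where
  module In  = Piece R mc π sat
  module Out = Piece R mc (not ∘ π) (Saturated-not R π sat)
  module Pts = Partition π
  module Mem = Partition In.side

  fam-split : ∀ i k → fam (In.piece ⊔ Out.piece) i k ≡ fam R (Mem.ι⊎ i) (Pts.ι⊎ k)
  fam-split i k with splitView Mem.c₁ Mem.c₂ i | splitView Pts.c₁ Pts.c₂ k
  ... | left i'  | left k'  rewrite Mem.ι⊎-↑ˡ i' | Pts.ι⊎-↑ˡ k' = fam-⊔ˡˡ In.piece Out.piece i' k'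
  ... | left i'  | right k' rewrite Mem.ι⊎-↑ˡ i' | Pts.ι⊎-↑ʳ k' =
        trans (fam-⊔ˡʳ In.piece Out.piece i' k') (sym (In.fam-off-side (In.Mem.ι i') (Out.Pts.ι k')
          (λ e → true≢false (trans (sym (In.Mem.ι-π i')) (trans (sym e) (not≡true⁻ (Out.Pts.ι-π k')))))))
  ... | right i' | left k'  rewrite Mem.ι⊎-↑ʳ i' | Pts.ι⊎-↑ˡ k' =
        trans (fam-⊔ʳˡ In.piece Out.piece i' k') (sym (In.fam-off-side (Out.Mem.ι i') (In.Pts.ι k')
          (λ e → true≢false (trans (sym (In.Pts.ι-π k')) (trans e (not≡true⁻ (Out.Mem.ι-π i')))))))
  ... | right i' | right k' rewrite Mem.ι⊎-↑ʳ i' | Pts.ι⊎-↑ʳ k' = fam-⊔ʳʳ In.piece Out.piece i' k'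

  ord-across : ∀ i j → In.side i ≢ In.side j → ord R i j ≡ false
  ord-across i j ne with ord R i j in e
  ... | false = refl
  ... | true  = ⊥-elim (ne (In.ord-side i j e))

  ord-split : ∀ i j → ord (In.piece ⊔ Out.piece) i j ≡ ord R (Mem.ι⊎ i) (Mem.ι⊎ j)
  ord-split i j with splitView Mem.c₁ Mem.c₂ i | splitView Mem.c₁ Mem.c₂ j
  ... | left i'  | left j'  rewrite Mem.ι⊎-↑ˡ i' | Mem.ι⊎-↑ˡ j' = ord-⊔ˡˡ In.piece Out.piece i' j'
  ... | left i'  | right j' rewrite Mem.ι⊎-↑ˡ i' | Mem.ι⊎-↑ʳ j' =
        trans (ord-⊔ˡʳ In.piece Out.piece i' j') (sym (ord-across _ _
          (λ e → true≢false (trans (sym (In.Mem.ι-π i')) (trans e (not≡true⁻ (Out.Mem.ι-π j')))))))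
  ... | right i' | left j'  rewrite Mem.ι⊎-↑ʳ i' | Mem.ι⊎-↑ˡ j' =
        trans (ord-⊔ʳˡ In.piece Out.piece i' j') (sym (ord-across _ _
          (λ e → true≢false (trans (sym (In.Mem.ι-π j')) (trans (sym e) (not≡true⁻ (Out.Mem.ι-π i')))))))
  ... | right i' | right j' rewrite Mem.ι⊎-↑ʳ i' | Mem.ι⊎-↑ʳ j' = ord-⊔ʳʳ In.piece Out.piece i' j'

  split-≅ : R ≅ (In.piece ⊔ Out.piece)
  split-≅ = record
    { σ = Pts.↔-partition ; τ = Mem.↔-partition
    ; fam-resp = λ i k → trans (fam-split _ _) (cong₂ (fam R) (Mem.ι⊎-↔-partition i) (Pts.ι⊎-↔-partition k))
    ; ord-resp = λ i j → trans (ord-split _ _) (cong₂ (ord R) (Mem.ι⊎-↔-partition i) (Mem.ι⊎-↔-partition j)) }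

pathConnected-trans : ∀ {R a b c} → PathConnected R a b → PathConnected R b c → PathConnected R a c
pathConnected-trans (here a)         q = q
pathConnected-trans (step i pa pc p) q = step i pa pc (pathConnected-trans p q)

pathConnected-sym : ∀ {R a b} → PathConnected R a b → PathConnected R b a
pathConnected-sym (here a)                 = here a
pathConnected-sym {a = a} (step i pa pc p) = pathConnected-trans (pathConnected-sym p) (step i pc pa (here a))

-- The component of a point z, computed as the stationary value of the
-- sequence reach 0 = {z}, reach (t + 1) = reach t ∪ ⋃ {supp A_i : A_i meets reach t}.
module Component (R : Raw) (mc : IsMultiComplex R) (z : Fin (n R)) where
  N = n R

  positiveᵇ : ℕ → Bool
  positiveᵇ zero    = false
  positiveᵇ (suc _) = true

  positiveᵇ⁻ : ∀ x → positiveᵇ x ≡ true → 0 < x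
  positiveᵇ⁻ (suc x) _ = s≤s z≤n

  positiveᵇ⁺ : ∀ x → 0 < x → positiveᵇ x ≡ true
  positiveᵇ⁺ (suc x) _ = refl

  meets : (Fin N → Bool) → Fin (m R) → Bool
  meets s i = any (λ a → s a ∧ positiveᵇ (fam R i a)) (allFin N)

  enters : (Fin N → Bool) → Fin N → Fin (m R) → Bool
  enters s k i = meets s i ∧ positiveᵇ (fam R i k)

  grow : (Fin N → Bool) → Fin N → Bool
  grow s k = s k ∨ any (enters s k) (allFin (m R))

  grow-cong : ∀ s s' → (∀ k → s k ≡ s' k) → ∀ k → grow s k ≡ grow s' k
  grow-cong s s' h k = cong₂ _∨_ (h k) (any-cong _ _ (allFin (m R)) (λ i →
    cong (_∧ positiveᵇ (fam R i k)) (any-cong _ _ (allFin N) (λ a → cong (_∧ positiveᵇ (fam R i a)) (h a)))))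

  reach : ℕ → Fin N → Bool
  reach zero    k = isYes (z ≟ k)
  reach (suc t) k = grow (reach t) k

  size : (Fin N → Bool) → ℕ
  size s = length (filterᵇ s (allFin N))

  reach-mono : ∀ t k → reach t k ≡ true → reach (suc t) k ≡ true
  reach-mono t k = ∨≡true⁺ˡ

  Stable : ℕ → Set
  Stable t = ∀ k → reach (suc t) k ≡ reach t k

  stable-suc : ∀ t → Stable t → Stable (suc t)
  stable-suc t st = grow-cong (reach (suc t)) (reach t) st

  stable-or-grows : ∀ t → Stable t ⊎ (size (reach t) < size (reach (suc t)))
  stable-or-grows t = bool-cases (allᵇ (λ k → reach (suc t) k ⇒ᵇ reach t k) (allFin N))
    (λ h → inj₁ (λ k → bool-ext (⇒ᵇ≡true⁻ (allFinᵇ≡true⁻ _ h k)) (reach-mono t k)))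
    (λ h → let k , _ , q = allᵇ≡false⁻ _ (allFin N) h ; new , old = ⇒ᵇ≡false⁻ q in
       inj₂ (length-filterᵇ-strict (reach t) (reach (suc t)) (allFin N) (reach-mono t) k (∈-allFin k) new old))

  z∈reach0 : reach 0 z ≡ true
  z∈reach0 = isYes-true (z ≟ z) refl

  size-reach0 : 1 ≤ size (reach 0)
  size-reach0 = subst (λ x → length x < size (reach 0)) (filterᵇ-none (λ _ → false) (allFin N) (λ _ _ → refl))
    (length-filterᵇ-strict (λ _ → false) (reach 0) (allFin N) (λ x ()) z (∈-allFin z) z∈reach0 refl)

  stable-or-large : ∀ t → Stable t ⊎ (suc (suc t) ≤ size (reach (suc t)))
  stable-or-large zero with stable-or-grows 0
  ... | inj₁ st = inj₁ st
  ... | inj₂ lt = inj₂ (ℕP.≤-trans (s≤s size-reach0) lt)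
  stable-or-large (suc t) with stable-or-large t
  ... | inj₁ st = inj₁ (stable-suc t st)
  ... | inj₂ le with stable-or-grows (suc t)
  ...   | inj₁ st = inj₁ st
  ...   | inj₂ lt = inj₂ (ℕP.≤-trans (s≤s le) lt)

  -- A strictly growing sequence of subsets of Fin N stops within N steps.
  stable-N : Stable N
  stable-N with stable-or-large N
  ... | inj₁ st = st
  ... | inj₂ le = ⊥-elim (ℕP.<-irrefl refl
          (ℕP.≤-trans le (ℕP.≤-trans (subst (size (reach (suc N)) ≤_) (LP.length-tabulate {n = N} id)
                                              (LP.length-filter (T? ∘ reach (suc N)) (allFin N)))
                                       (ℕP.n≤1+n N))))

  component : Fin N → Bool
  component = reach N

  component-saturated : Saturated R component
  component-saturated i a b pa pb a∈ = trans (sym (stable-N b)) (∨≡true⁺ʳ (any≡true⁺ _ i (∈-allFin i)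
    (∧≡true⁺ (any≡true⁺ _ a (∈-allFin a) (∧≡true⁺ a∈ (positiveᵇ⁺ _ pa))) (positiveᵇ⁺ _ pb))))

  reach⊆component : ∀ t k → t ≤ N → reach t k ≡ true → component k ≡ true
  reach⊆component t k le h = subst (λ x → reach x k ≡ true) (ℕP.m∸n+n≡m le) (up (N ℕ.∸ t) h)
    where
    up : ∀ d → reach t k ≡ true → reach (d ℕ.+ t) k ≡ true
    up zero    h = h
    up (suc d) h = reach-mono (d ℕ.+ t) k (up d h)

  z∈component : component z ≡ true
  z∈component = reach⊆component 0 z z≤n z∈reach0

  open Splitting R mc component component-saturated public

  private
    zᶜ = In.Pts.ρ z z∈component

  reach⇒path : ∀ t → t ≤ N → ∀ k (k∈ : component k ≡ true) → reach t k ≡ true →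
    PathConnected In.piece (In.Pts.ρ k k∈) zᶜ
  reach⇒path zero le k k∈ h with toWitness {a? = z ≟ k} (≡true⇒T h)
  ... | refl = subst (λ x → PathConnected In.piece x zᶜ) (In.Pts.ρ-irrelevant z z∈component k∈) (here _)
  reach⇒path (suc t) le k k∈ h = bool-cases (reach t k)
    (λ old → reach⇒path t le' k k∈ old)
    (λ new → let i , _ , i-hit = any≡true⁻ (enters (reach t) k) (allFin (m R)) (subst (λ b → (b ∨ any (enters (reach t) k) (allFin (m R))) ≡ true) new h)
                 meets-i , k∈i = ∧≡true⁻ {meets (reach t) i} i-hit
                 a , _ , a-hit = any≡true⁻ (λ a → reach t a ∧ positiveᵇ (fam R i a)) (allFin N) meets-i
                 a-reached , a∈i = ∧≡true⁻ {reach t a} a-hit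
                 a∈ = reach⊆component t a le' a-reached
                 i-in : In.side i ≡ true
                 i-in = trans (sym (In.side-support i a (positiveᵇ⁻ _ a∈i))) a∈
             in step (In.Mem.ρ i i-in)
                  (subst₂ (λ x y → 0 < fam R x y) (sym (In.Mem.ι∘ρ i i-in)) (sym (In.Pts.ι∘ρ k k∈)) (positiveᵇ⁻ _ k∈i))
                  (subst₂ (λ x y → 0 < fam R x y) (sym (In.Mem.ι∘ρ i i-in)) (sym (In.Pts.ι∘ρ a a∈)) (positiveᵇ⁻ _ a∈i))
                  (reach⇒path t le' a a∈ a-reached))
    where le' = ℕP.≤-trans (ℕP.n≤1+n t) le

  componentMC : MultiComplex
  componentMC = record { raw = In.piece ; isMC = In.piece-isMultiComplex }

  component-connected : Connected componentMC
  component-connected a b = pathConnected-trans (to-z a) (pathConnected-sym (to-z b))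
    where
    to-z : ∀ x → PathConnected In.piece x zᶜ
    to-z x = subst (λ y → PathConnected In.piece y zᶜ) (In.Pts.ρ∘ι x (In.Pts.ι-π x))
               (reach⇒path N ℕP.≤-refl (In.Pts.ι x) (In.Pts.ι-π x) (In.Pts.ι-π x))

  restMC : MultiComplex
  restMC = record { raw = Out.piece ; isMC = Out.piece-isMultiComplex }

  rest-smaller : n Out.piece < N
  rest-smaller = subst (n Out.piece <_) (trans (cong length (filterᵇ-all (λ _ → true) (allFin N) (λ _ _ → refl)))
                                               (LP.length-tabulate {n = N} id))
    (length-filterᵇ-strict (not ∘ component) (λ _ → true) (allFin N) (λ _ _ → refl) z (∈-allFin z) refl
                           (cong not z∈component))

P-emptyRaw : P emptyRaw ∼ oneH
P-emptyRaw = ∼-iso (record { σ = ↔-refl ; τ = ↔-refl ; fam-resp = λ () ; ord-resp = λ () })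

-- With no points there are no (non-empty) members either.
≅-emptyRaw : ∀ (D : MultiComplex) → n (raw D) ≡ 0 → raw D ≅ emptyRaw
≅-emptyRaw D eq = record
  { σ = mk↔ₛ′ (λ k → ⊥-elim (no-point k)) (λ ()) (λ ()) (λ k → ⊥-elim (no-point k))
  ; τ = mk↔ₛ′ (λ i → ⊥-elim (no-point (witness i))) (λ ()) (λ ()) (λ i → ⊥-elim (no-point (witness i)))
  ; fam-resp = λ i k → ⊥-elim (no-point k)
  ; ord-resp = λ i j → ⊥-elim (no-point (witness i)) }
  where
  no-point : Fin (n (raw D)) → ⊥
  no-point k with () ← subst Fin eq k
  witness : Fin (m (raw D)) → Fin (n (raw D))
  witness i = proj₁ (IsMultiComplex.nonempty (isMC D) i)

P-pointless : ∀ (D : MultiComplex) → n (raw D) ≡ 0 → P (raw D) ∼ oneH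
P-pointless D eq = ∼-trans (IsoInvariance.P-resp-≅ (≅-emptyRaw D eq)) P-emptyRaw

zero-or-point : ∀ N → N ≡ 0 ⊎ Fin N
zero-or-point zero    = inj₁ refl
zero-or-point (suc N) = inj₂ F.zero

-- Induction on the number of points: split off the component of some point.
P-monomial : ∀ k (D : MultiComplex) → n (raw D) ≤ k → Σ (List ConnectedMC) λ Ds → P (raw D) ∼ evalMonomial Ds
P-monomial zero D le = [] , P-pointless D (ℕP.n≤0⇒n≡0 le)
P-monomial (suc k) D le with zero-or-point (n (raw D))
... | inj₁ eq = [] , P-pointless D eq
... | inj₂ z =
  let open Component (raw D) (isMC D) z
      Ds , P-rest = P-monomial k restMC (ℕP.≤-pred (ℕP.≤-trans rest-smaller le))
  in (componentMC , component-connected) ∷ Ds ,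
     ∼-trans (IsoInvariance.P-resp-≅ split-≅) (∼-trans (Union.P-⊔ In.piece Out.piece) (*H-congʳ (P In.piece) P-rest))

1·H : ∀ (M : HC) → (1 ·H M) ≡ M
1·H []            = refl
1·H ((c , X) ∷ M) = cong₂ _∷_ (cong (_, X) (ℤP.*-identityˡ c)) (1·H M)

sum-P-polynomial : ∀ R → IsMultiComplex R → ∀ (L : List (Subset (m R))) → (∀ S → S ∈ L → isSubᵇ R S ≡ true) →
  Σ Poly λ p → concatMap (λ S → P (restrict R S)) L ∼ evalPoly p
sum-P-polynomial R mc []      h = [] , ∼-refl
sum-P-polynomial R mc (S ∷ L) h =
  let D  = record { raw = restrict R S ; isMC = restrict-isMultiComplex R mc S (h S (here refl)) }
      Ds , P-D = P-monomial (n R) D ℕP.≤-refl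
      p , rest = sum-P-polynomial R mc L (λ T T∈ → h T (there T∈))
  in (1 , Ds) ∷ p , ++-cong (∼-trans P-D (≡⇒∼ (sym (1·H _)))) rest

corollary4p8 : (C : MultiComplex) → Σ Poly λ p → (basis (raw C) ∼ evalPoly p)
corollary4p8 C =
  let p , Σ-P≈p = sum-P-polynomial (raw C) (isMC C) (X (raw C)) (λ S S∈ → ∈X⁻ (raw C) S∈)
  in p , ∼-trans (basis-mobius-inversion (raw C)) Σ-P≈p
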